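{- For all integers $n\ge 1$ and $\omega\ge 2n$, $$\sum_{j=0}^{\omega}\frac{\Gamma(\omega+\frac52)}{(\omega-j)!\,(j+n)!\,(2j+3)}\sum_{l=0}^{j+1}\frac{(-1)^l\,l^2\,(l^2-1)^{j+n}}{(j+l+1)!\,(j-l+1)!}=\frac{(-1)^{n+1}\sqrt{\pi}}{8\cdot n!}.$$ -}

module Defs where

open import Data.Nat as ℕ using (ℕ; zero; suc; _∸_; _!; NonZero)
open import Data.Nat.Properties using (_!≢0; m*n≢0; m^n≢0)
open import Data.Integer as ℤ using (ℤ; +_)
open import Data.Rational using (ℚ; _/_; _+_; _*_; 0ℚ)
open import Data.List using (List; foldr; map; upTo)

-- Σ_{i=0}^{n} f i  over ℚ  (note: the range 0..n is inclusive)
sumTo : ℕ → (ℕ → ℚ) → ℚ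
sumTo n f = foldr _+_ 0ℚ (map f (upTo (suc n)))

invFact : ℕ → ℚ
invFact n = (+ 1) / (n !)
  where instance _ = n !≢0

sgn : ℕ → ℤ
sgn k = (ℤ.- + 1) ℤ.^ k

-- Γ(ω + 5/2) / √π  =  (2ω+4)! / (4^(ω+2) · (ω+2)!)   (standard half-integer value of Γ)
gammaOmegaPlus5/2OverSqrtPi : ℕ → ℚ
gammaOmegaPlus5/2OverSqrtPi ω =
  (+ ((2 ℕ.* ω ℕ.+ 4) !)) / (4 ℕ.^ (ω ℕ.+ 2) ℕ.* (ω ℕ.+ 2) !)
  where instance
    _ = m*n≢0 (4 ℕ.^ (ω ℕ.+ 2)) ((ω ℕ.+ 2) !) {{m^n≢0 4 (ω ℕ.+ 2)}} {{(ω ℕ.+ 2) !≢0}}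

-- inner sum: Σ_{l=0}^{j+1} (-1)^l l² (l²-1)^{j+n} / ((j+l+1)! (j-l+1)!)
-- (for 0 ≤ l ≤ j+1 the truncated subtraction j+1∸l is the true value j-l+1)
innerSum : ℕ → ℕ → ℚ
innerSum n j = sumTo (suc j) λ l →
  ((sgn l ℤ.* (+ (l ℕ.* l)) ℤ.* ((+ (l ℕ.* l) ℤ.- + 1) ℤ.^ (j ℕ.+ n))) / 1)
    * invFact (j ℕ.+ l ℕ.+ 1) * invFact (suc j ∸ l)

lhsOverSqrtPi : ℕ → ℕ → ℚ
lhsOverSqrtPi n ω = sumTo ω λ j →
  gammaOmegaPlus5/2OverSqrtPi ω * invFact (ω ∸ j) * invFact (j ℕ.+ n)
    * ((+ 1) / (3 ℕ.+ 2 ℕ.* j)) * innerSum n j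

rhsOverSqrtPi : ℕ → ℚ
rhsOverSqrtPi n = (sgn (suc n) / 8) * invFact n

-- The inner sum J_N(m) = ∑ₗ (-1)ˡ l² (l²-1)ᴺ / ((m+l)! (m-l)!) obeys
-- J_{N+1}(m+1) = -J_N(m) + ((m+1)²-1) J_N(m+1) and vanishes for m ≥ N+2. Hence the inner sum of the
-- theorem equals -½ (-1)ʲ (j+n)!/j! · F_n(j), where F_0 = 1 and (x+n+1) F_{n+1}(x) - x F_{n+1}(x-1)
-- = x (x+2) F_n(x) define polynomials of degree 2n. The outer sum becomes a multiple of
-- ∑ⱼ (-1)ʲ C(ω,j) F_n(j) / (2j+3); as 2n ≤ ω, the ω-th finite difference kills (F_n(x) - F_n(-3/2)) / (x + 3/2),
-- and what remains is F_n(-3/2) times the partial-fraction sum 1 / (2 (3/2)_{ω+1}), which cancels Γ(ω+5/2)/√π.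
-- Finally F_n(-3/2) = (-1)ⁿ/n!: for h_k(x) = (x)_k F_k(x-1) the series H(x) = ∑ₖ h_k(x) tᵏ satisfies
-- H(x) H(-1-x) = H(x-1) H(-x), so this product is a 1-periodic polynomial in x, hence equal to its value
-- 1 + t at x = 0; at x = -1/2 this says H(-1/2) = √(1+t), i.e. h_k(-1/2) = C(1/2, k).

module Submission where

open import Data.Integer as ℤ using (ℤ)
import Data.Integer.Properties as ℤ
import Data.Integer.Tactic.RingSolver as ℤ-Solver
open import Data.List using (List; []; _∷_; foldr; map; applyUpTo; length)
open import Data.List.Properties using (map-upTo; length-map)
open import Data.Nat as ℕ using (ℕ; zero; suc; _∸_; _*_; _^_; _!; NonZero; _≤_; z≤n; s≤s)
import Data.Nat.Properties as ℕ
open import Data.Nat.Properties using (_!≢0; m*n≢0; m^n≢0)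
import Data.Nat.Tactic.RingSolver as ℕ-Solver
open import Data.Product using (Σ-syntax; _×_; _,_; proj₁; proj₂)
open import Data.Rational using (ℚ; _/_; _+_; _-_; -_; 0ℚ; 1ℚ; ½; -½; 1/_; _≟_; ≢-nonZero)
  renaming (_*_ to _·_)
open import Data.Rational.Literals using (fromℤ)
open import Data.Rational.Properties
open import Algebra.Properties.Ring +-*-ring using (-1*x≈-x)
import Data.Rational.Unnormalised as ℚᵘ
import Data.Rational.Unnormalised.Properties as ℚᵘ
open import Data.Sum using (inj₁; inj₂)
open import Function using (_∘_)
open import Level using (0ℓ)
open import Relation.Binary.PropositionalEquality
open import Relation.Nullary.Decidable using (dec⇒maybe)
open import Tactic.RingSolver using (solve-∀)
open import Tactic.RingSolver.Core.AlmostCommutativeRing using (AlmostCommutativeRing; fromCommutativeRing)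

open import Defs

ℚ-ring : AlmostCommutativeRing 0ℓ 0ℓ
ℚ-ring = fromCommutativeRing +-*-commutativeRing (λ x → dec⇒maybe (0ℚ ≟ x))

cong₃ : ∀ {A B C D : Set} (f : A → B → C → D) {x x′ y y′ z z′} → x ≡ x′ → y ≡ y′ → z ≡ z′ → f x y z ≡ f x′ y′ z′
cong₃ f refl refl refl = refl
fromℕ : ℕ → ℚ
fromℕ n = fromℤ (ℤ.+ n)

1/ℕ : (d : ℕ) → .{{NonZero d}} → ℚ
1/ℕ d = ℤ.+ 1 / d

/1≡fromℤ : ∀ z → z / 1 ≡ fromℤ z
/1≡fromℤ z = toℚᵘ-injective (toℚᵘ-fromℚᵘ (ℚᵘ.mkℚᵘ z 0))

fromℤ-homo-+ : ∀ a b → fromℤ (a ℤ.+ b) ≡ fromℤ a + fromℤ b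
fromℤ-homo-+ a b = toℚᵘ-injective (ℚᵘ.≃-sym (ℚᵘ.≃-trans (toℚᵘ-homo-+ (fromℤ a) (fromℤ b))
  (ℚᵘ.*≡* (cross-multiplied a b))))
  where
  cross-multiplied : ∀ a b → (a ℤ.* ℤ.+ 1 ℤ.+ b ℤ.* ℤ.+ 1) ℤ.* ℤ.+ 1 ≡ (a ℤ.+ b) ℤ.* ℤ.+ 1
  cross-multiplied = ℤ-Solver.solve-∀

fromℤ-homo-* : ∀ a b → fromℤ (a ℤ.* b) ≡ fromℤ a · fromℤ b
fromℤ-homo-* a b = toℚᵘ-injective (ℚᵘ.≃-sym (toℚᵘ-homo-* (fromℤ a) (fromℤ b)))

fromℕ-homo-+ : ∀ m n → fromℕ (m ℕ.+ n) ≡ fromℕ m + fromℕ n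
fromℕ-homo-+ m n = fromℤ-homo-+ (ℤ.+ m) (ℤ.+ n)

fromℕ-homo-* : ∀ m n → fromℕ (m * n) ≡ fromℕ m · fromℕ n
fromℕ-homo-* m n = trans (cong fromℤ (ℤ.pos-* m n)) (fromℤ-homo-* (ℤ.+ m) (ℤ.+ n))

fromℕ-suc : ∀ n → fromℕ (suc n) ≡ fromℕ n + 1ℚ
fromℕ-suc n = trans (fromℕ-homo-+ 1 n) (+-comm 1ℚ (fromℕ n))

fromℕ-∸ : ∀ {i N} → i ≤ N → fromℕ N ≡ fromℕ i + fromℕ (N ∸ i)
fromℕ-∸ {i} {N} i≤N = trans (cong fromℕ (sym (ℕ.m+[n∸m]≡n i≤N))) (fromℕ-homo-+ i (N ∸ i))

fromℕ-injective : ∀ {m n} → fromℕ m ≡ fromℕ n → m ≡ n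
fromℕ-injective refl = refl

fromℕ[1+n]≢0 : ∀ n → fromℕ (suc n) ≢ 0ℚ
fromℕ[1+n]≢0 n ()

1/ℕ-inverseˡ : ∀ d .{{_ : NonZero d}} → 1/ℕ d · fromℕ d ≡ 1ℚ
1/ℕ-inverseˡ d@(suc d-1) = toℚᵘ-injective (ℚᵘ.≃-trans (toℚᵘ-homo-* (1/ℕ d) (fromℕ d))
  (ℚᵘ.≃-trans (ℚᵘ.*-cong (toℚᵘ-fromℚᵘ (ℚᵘ.mkℚᵘ (ℤ.+ 1) d-1)) ℚᵘ.≃-refl)
              (ℚᵘ.*≡* (cong (λ k → ℤ.+ suc k) (cross-multiplied d-1)))))
  where
  cross-multiplied : ∀ m → (m ℕ.+ 0 * suc m) * 1 ≡ m * 1 ℕ.+ 0 * suc (m * 1)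
  cross-multiplied = ℕ-Solver.solve-∀

1/ℕ-inverseʳ : ∀ d .{{_ : NonZero d}} → fromℕ d · 1/ℕ d ≡ 1ℚ
1/ℕ-inverseʳ d = trans (*-comm (fromℕ d) (1/ℕ d)) (1/ℕ-inverseˡ d)

/≡fromℤ·1/ℕ : ∀ z d .{{_ : NonZero d}} → z / d ≡ fromℤ z · 1/ℕ d
/≡fromℤ·1/ℕ z d@(suc d-1) = toℚᵘ-injective (ℚᵘ.≃-trans (toℚᵘ-fromℚᵘ (ℚᵘ.mkℚᵘ z d-1))
  (ℚᵘ.≃-sym (ℚᵘ.≃-trans (toℚᵘ-homo-* (fromℤ z) (1/ℕ d))
    (ℚᵘ.≃-trans (ℚᵘ.*-cong (ℚᵘ.≃-refl {ℚᵘ.mkℚᵘ z 0}) (toℚᵘ-fromℚᵘ (ℚᵘ.mkℚᵘ (ℤ.+ 1) d-1)))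
                (ℚᵘ.*≡* (cong₂ (λ a k → a ℤ.* ℤ.+ suc k) (ℤ.*-identityʳ z) (sym (ℕ.+-identityʳ d-1))))))))

*-cancelˡ-≢0 : ∀ {a b c} → a ≢ 0ℚ → a · b ≡ a · c → b ≡ c
*-cancelˡ-≢0 {a} {b} {c} a≢0 ab≡ac = begin
  b                ≡⟨ sym (*-identityˡ b) ⟩
  1ℚ · b           ≡⟨ cong (_· b) (sym (*-inverseˡ a)) ⟩
  1/ a · a · b     ≡⟨ *-assoc (1/ a) a b ⟩
  1/ a · (a · b)   ≡⟨ cong (1/ a ·_) ab≡ac ⟩
  1/ a · (a · c)   ≡⟨ *-assoc (1/ a) a c ⟨
  1/ a · a · c     ≡⟨ cong (_· c) (*-inverseˡ a) ⟩
  1ℚ · c           ≡⟨ *-identityˡ c ⟩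
  c                ∎
  where
  open ≡-Reasoning
  instance _ = ≢-nonZero a≢0

*-≢0 : ∀ {a b} → a ≢ 0ℚ → b ≢ 0ℚ → a · b ≢ 0ℚ
*-≢0 {a} {b} a≢0 b≢0 ab≡0 = b≢0 (*-cancelˡ-≢0 a≢0 (trans ab≡0 (sym (*-zeroʳ a))))

invFact-suc : ∀ n → invFact (suc n) · fromℕ (suc n) ≡ invFact n
invFact-suc n = begin
  invFact (suc n) · fromℕ (suc n)                             ≡⟨ *-identityʳ _ ⟨
  invFact (suc n) · fromℕ (suc n) · 1ℚ                        ≡⟨ cong (invFact (suc n) · fromℕ (suc n) ·_) (1/ℕ-inverseʳ (n !) {{n !≢0}}) ⟨
  invFact (suc n) · fromℕ (suc n) · (fromℕ (n !) · invFact n) ≡⟨ shuffle (invFact (suc n)) (fromℕ (suc n)) (fromℕ (n !)) (invFact n) ⟩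
  fromℕ (suc n) · fromℕ (n !) · invFact (suc n) · invFact n   ≡⟨ cong (λ t → t · invFact (suc n) · invFact n) (fromℕ-homo-* (suc n) (n !)) ⟨
  fromℕ (suc n !) · invFact (suc n) · invFact n               ≡⟨ cong (_· invFact n) (1/ℕ-inverseʳ (suc n !) {{suc n !≢0}}) ⟩
  1ℚ · invFact n                                              ≡⟨ *-identityˡ _ ⟩
  invFact n                                                   ∎
  where
  open ≡-Reasoning
  shuffle : ∀ a b c d → a · b · (c · d) ≡ b · c · a · d
  shuffle = solve-∀ ℚ-ring

∑ : ℕ → (ℕ → ℚ) → ℚ
∑ zero    f = f 0
∑ (suc n) f = f 0 + ∑ n (f ∘ suc)

syntax ∑ n (λ i → e) = ∑[ i ≤ n ] e

sumTo≡∑ : ∀ n f → sumTo n f ≡ ∑ n f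
sumTo≡∑ n f = trans (cong (foldr _+_ 0ℚ) (map-upTo f (suc n))) (go n f)
  where
  go : ∀ n f → foldr _+_ 0ℚ (applyUpTo f (suc n)) ≡ ∑ n f
  go zero    f = +-identityʳ (f 0)
  go (suc n) f = cong (f 0 +_) (go n (f ∘ suc))

∑-cong≤ : ∀ n {f g} → (∀ i → i ≤ n → f i ≡ g i) → ∑ n f ≡ ∑ n g
∑-cong≤ zero    f≡g = f≡g 0 z≤n
∑-cong≤ (suc n) f≡g = cong₂ _+_ (f≡g 0 z≤n) (∑-cong≤ n (λ i i≤n → f≡g (suc i) (s≤s i≤n)))

∑-cong : ∀ n {f g} → (∀ i → f i ≡ g i) → ∑ n f ≡ ∑ n g
∑-cong n f≡g = ∑-cong≤ n (λ i _ → f≡g i)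

∑-zero : ∀ n {f} → (∀ i → i ≤ n → f i ≡ 0ℚ) → ∑ n f ≡ 0ℚ
∑-zero zero    f≡0 = f≡0 0 z≤n
∑-zero (suc n) f≡0 = cong₂ _+_ (f≡0 0 z≤n) (∑-zero n (λ i i≤n → f≡0 (suc i) (s≤s i≤n)))

∑-+ : ∀ n f g → ∑[ i ≤ n ] (f i + g i) ≡ ∑ n f + ∑ n g
∑-+ zero    f g = refl
∑-+ (suc n) f g = trans (cong ((f 0 + g 0) +_) (∑-+ n (f ∘ suc) (g ∘ suc)))
                        (interchange (f 0) (g 0) (∑ n (f ∘ suc)) (∑ n (g ∘ suc)))
  where
  interchange : ∀ a b c d → a + b + (c + d) ≡ a + c + (b + d)
  interchange = solve-∀ ℚ-ring

∑-*ˡ : ∀ n c f → ∑[ i ≤ n ] (c · f i) ≡ c · ∑ n f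
∑-*ˡ zero    c f = refl
∑-*ˡ (suc n) c f = trans (cong (c · f 0 +_) (∑-*ˡ n c (f ∘ suc))) (sym (*-distribˡ-+ c _ _))

∑-neg : ∀ n f → ∑[ i ≤ n ] (- f i) ≡ - ∑ n f
∑-neg zero    f = refl
∑-neg (suc n) f = trans (cong (- f 0 +_) (∑-neg n (f ∘ suc))) (sym (neg-distrib-+ (f 0) _))

∑-last : ∀ n f → ∑ (suc n) f ≡ ∑ n f + f (suc n)
∑-last zero    f = refl
∑-last (suc n) f = trans (cong (f 0 +_) (∑-last n (f ∘ suc))) (sym (+-assoc (f 0) _ _))

∑-telescope : ∀ n (A : ℕ → ℚ) → ∑[ i ≤ n ] (A i - A (suc i)) ≡ A 0 - A (suc n)
∑-telescope zero    A = refl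
∑-telescope (suc n) A = begin
  A 0 - A 1 + ∑[ i ≤ n ] (A (suc i) - A (suc (suc i)))  ≡⟨ cong ((A 0 - A 1) +_) (∑-telescope n (A ∘ suc)) ⟩
  A 0 - A 1 + (A 1 - A (suc (suc n)))                  ≡⟨ collapse (A 0) (A 1) (A (suc (suc n))) ⟩
  A 0 - A (suc (suc n))                                ∎
  where
  open ≡-Reasoning
  collapse : ∀ a b c → a - b + (b - c) ≡ a - c
  collapse = solve-∀ ℚ-ring

-- Polynomial functions of degree at most d, presented by the division f x = f 0 + x · g x.
Degree≤ : ℕ → (ℚ → ℚ) → Set
Degree≤ zero    f = ∀ x → f x ≡ f 0ℚ
Degree≤ (suc d) f = Σ[ g ∈ (ℚ → ℚ) ] Degree≤ d g × (∀ x → f x ≡ f 0ℚ + x · g x)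

Degree≤-resp-≗ : ∀ d {f g} → (∀ x → f x ≡ g x) → Degree≤ d f → Degree≤ d g
Degree≤-resp-≗ zero    f≗g f-const x = trans (sym (f≗g x)) (trans (f-const x) (f≗g 0ℚ))
Degree≤-resp-≗ (suc d) f≗g (f′ , f′-deg , f≡) =
  f′ , f′-deg , λ x → trans (sym (f≗g x)) (trans (f≡ x) (cong (_+ x · f′ x) (f≗g 0ℚ)))

Degree≤-const : ∀ d c → Degree≤ d (λ _ → c)
Degree≤-const zero    c x = refl
Degree≤-const (suc d) c = (λ _ → 0ℚ) , Degree≤-const d 0ℚ , λ x → sym (c+x·0≡c c x)
  where
  c+x·0≡c : ∀ c x → c + x · 0ℚ ≡ c
  c+x·0≡c = solve-∀ ℚ-ring

Degree≤-suc : ∀ d {f} → Degree≤ d f → Degree≤ (suc d) f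
Degree≤-suc zero    {f} f-const = Degree≤-resp-≗ 1 (λ x → sym (f-const x)) (Degree≤-const 1 (f 0ℚ))
Degree≤-suc (suc d) (f′ , f′-deg , f≡) = f′ , Degree≤-suc d f′-deg , f≡

Degree≤-mono : ∀ {d e f} → d ≤ e → Degree≤ d f → Degree≤ e f
Degree≤-mono {e = zero}  z≤n     f-deg = f-deg
Degree≤-mono {e = suc e} z≤n     f-deg = Degree≤-suc e (Degree≤-mono z≤n f-deg)
Degree≤-mono (s≤s d≤e) (f′ , f′-deg , f≡) = f′ , Degree≤-mono d≤e f′-deg , f≡

Degree≤-+ : ∀ d {f g} → Degree≤ d f → Degree≤ d g → Degree≤ d (λ x → f x + g x)
Degree≤-+ zero    f-const g-const x = cong₂ _+_ (f-const x) (g-const x)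
Degree≤-+ (suc d) {f} {g} (f′ , f′-deg , f≡) (g′ , g′-deg , g≡) =
  (λ x → f′ x + g′ x) , Degree≤-+ d f′-deg g′-deg ,
  λ x → trans (cong₂ _+_ (f≡ x) (g≡ x)) (regroup (f 0ℚ) (g 0ℚ) x (f′ x) (g′ x))
  where
  regroup : ∀ a b x c d → a + x · c + (b + x · d) ≡ a + b + x · (c + d)
  regroup = solve-∀ ℚ-ring

Degree≤-*ˡ : ∀ d c {f} → Degree≤ d f → Degree≤ d (λ x → c · f x)
Degree≤-*ˡ zero    c f-const x = cong (c ·_) (f-const x)
Degree≤-*ˡ (suc d) c {f} (f′ , f′-deg , f≡) =
  (λ x → c · f′ x) , Degree≤-*ˡ d c f′-deg ,
  λ x → trans (cong (c ·_) (f≡ x)) (distrib c (f 0ℚ) x (f′ x))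
  where
  distrib : ∀ c a x b → c · (a + x · b) ≡ c · a + x · (c · b)
  distrib = solve-∀ ℚ-ring

Degree≤-x* : ∀ d {f} → Degree≤ d f → Degree≤ (suc d) (λ x → x · f x)
Degree≤-x* d {f} f-deg = f , f-deg , λ x → sym (trans (cong (_+ x · f x) (*-zeroˡ (f 0ℚ))) (+-identityˡ _))

Degree≤-* : ∀ d e {f g} → Degree≤ d f → Degree≤ e g → Degree≤ (d ℕ.+ e) (λ x → f x · g x)
Degree≤-* zero    e {f} {g} f-const g-deg =
  Degree≤-resp-≗ e (λ x → cong (_· g x) (sym (f-const x))) (Degree≤-*ˡ e (f 0ℚ) g-deg)
Degree≤-* (suc d) e {f} {g} (f′ , f′-deg , f≡) g-deg =
  Degree≤-resp-≗ (suc (d ℕ.+ e)) (λ x → sym (trans (cong (_· g x) (f≡ x)) (distrib (f 0ℚ) x (f′ x) (g x))))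
    (Degree≤-+ (suc (d ℕ.+ e)) (Degree≤-mono (ℕ.m≤n+m e (suc d)) (Degree≤-*ˡ e (f 0ℚ) g-deg))
                               (Degree≤-x* (d ℕ.+ e) (Degree≤-* d e f′-deg g-deg)))
  where
  distrib : ∀ a x b c → (a + x · b) · c ≡ a · c + x · (b · c)
  distrib = solve-∀ ℚ-ring

Degree≤-translate : ∀ d c {f} → Degree≤ d f → Degree≤ d (λ x → f (x + c))
Degree≤-translate zero    c f-const x = trans (f-const (x + c)) (sym (f-const (0ℚ + c)))
Degree≤-translate (suc d) c {f} (f′ , f′-deg , f≡) =
  Degree≤-resp-≗ (suc d) (λ x → sym (trans (f≡ (x + c)) (regroup (f 0ℚ) x c (f′ (x + c)))))
    (Degree≤-+ (suc d) (Degree≤-suc d (Degree≤-+ d (Degree≤-const d (f 0ℚ)) (Degree≤-*ˡ d c f′+c-deg)))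
                       (Degree≤-x* d f′+c-deg))
  where
  f′+c-deg : Degree≤ d (λ x → f′ (x + c))
  f′+c-deg = Degree≤-translate d c f′-deg
  regroup : ∀ a x c b → a + (x + c) · b ≡ a + c · b + x · b
  regroup = solve-∀ ℚ-ring

Degree≤-reflect : ∀ d {f} → Degree≤ d f → Degree≤ d (λ x → f (- x))
Degree≤-reflect zero    f-const x = f-const (- x)
Degree≤-reflect (suc d) {f} (f′ , f′-deg , f≡) =
  (λ x → - f′ (- x)) ,
  Degree≤-resp-≗ d (λ x → -1*x≈-x (f′ (- x))) (Degree≤-*ˡ d (- 1ℚ) (Degree≤-reflect d f′-deg)) ,
  λ x → trans (f≡ (- x)) (move-neg (f 0ℚ) x (f′ (- x)))
  where
  move-neg : ∀ a x b → a + - x · b ≡ a + x · - b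
  move-neg = solve-∀ ℚ-ring

Degree≤-∑ : ∀ d n {f : ℕ → ℚ → ℚ} → (∀ i → i ≤ n → Degree≤ d (f i)) → Degree≤ d (λ x → ∑[ i ≤ n ] f i x)
Degree≤-∑ d zero    f-deg = f-deg 0 z≤n
Degree≤-∑ d (suc n) f-deg = Degree≤-+ d (f-deg 0 z≤n) (Degree≤-∑ d n (λ i i≤n → f-deg (suc i) (s≤s i≤n)))

Degree≤-x+c : ∀ c → Degree≤ 1 (λ x → x + c)
Degree≤-x+c c = (λ _ → 1ℚ) , Degree≤-const 0 1ℚ , λ x → x+c≡c+x·1 x c
  where
  x+c≡c+x·1 : ∀ x c → x + c ≡ (0ℚ + c) + x · 1ℚ
  x+c≡c+x·1 = solve-∀ ℚ-ring

-- Write f x = f 0 + x g x: f vanishes at 0, so g vanishes at every positive integer,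
-- i.e. g (y + 1) vanishes on ℕ, and induction on the degree applies to it.
vanishes-on-ℕ⇒≡0 : ∀ d {f} → Degree≤ d f → (∀ j → f (fromℕ j) ≡ 0ℚ) → ∀ x → f x ≡ 0ℚ
vanishes-on-ℕ⇒≡0 zero    f-const f[j]≡0 x = trans (f-const x) (f[j]≡0 0)
vanishes-on-ℕ⇒≡0 (suc d) {f} (g , g-deg , f≡) f[j]≡0 x = begin
  f x               ≡⟨ f≡ x ⟩
  f 0ℚ + x · g x    ≡⟨ cong₂ (λ a b → a + x · b) (f[j]≡0 0) (g≡0 x) ⟩
  0ℚ + x · 0ℚ       ≡⟨ 0+x·0≡0 x ⟩
  0ℚ                ∎
  where
  open ≡-Reasoning
  0+x·0≡0 : ∀ x → 0ℚ + x · 0ℚ ≡ 0ℚ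
  0+x·0≡0 = solve-∀ ℚ-ring
  g[1+j]≡0 : ∀ j → g (fromℕ (suc j)) ≡ 0ℚ
  g[1+j]≡0 j = *-cancelˡ-≢0 (fromℕ[1+n]≢0 j) (begin
    fromℕ (suc j) · g (fromℕ (suc j))         ≡⟨ +-identityˡ (fromℕ (suc j) · g (fromℕ (suc j))) ⟨
    0ℚ + fromℕ (suc j) · g (fromℕ (suc j))    ≡⟨ cong (_+ fromℕ (suc j) · g (fromℕ (suc j))) (f[j]≡0 0) ⟨
    f 0ℚ + fromℕ (suc j) · g (fromℕ (suc j))  ≡⟨ f≡ (fromℕ (suc j)) ⟨
    f (fromℕ (suc j))                         ≡⟨ f[j]≡0 (suc j) ⟩
    0ℚ                                        ≡⟨ *-zeroʳ (fromℕ (suc j)) ⟨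
    fromℕ (suc j) · 0ℚ                        ∎)
  g≡0 : ∀ y → g y ≡ 0ℚ
  g≡0 y = trans (cong g (sym (y-1+1≡y y)))
    (vanishes-on-ℕ⇒≡0 d (Degree≤-translate d 1ℚ g-deg)
      (λ j → trans (cong g (sym (fromℕ-suc j))) (g[1+j]≡0 j)) (y - 1ℚ))
    where
    y-1+1≡y : ∀ y → y - 1ℚ + 1ℚ ≡ y
    y-1+1≡y = solve-∀ ℚ-ring

sign : ℕ → ℚ
sign j = fromℤ (sgn j)

sign-suc : ∀ j → sign (suc j) ≡ - sign j
sign-suc j = trans (fromℤ-homo-* (ℤ.- ℤ.+ 1) (sgn j)) (-1*x≈-x (sign j))

-- Pascal's rule C(N+1,i) = C(N,i-1) + C(N,i), with binomial coefficients written as N!/(i!(N-i)!).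
pascal : ∀ N (a : ℕ → ℚ) →
  fromℕ (suc N) · ∑[ i ≤ suc N ] (a i · invFact i · invFact (suc N ∸ i)) ≡
  ∑[ i ≤ N ] (a (suc i) · invFact i · invFact (N ∸ i)) + ∑[ i ≤ N ] (a i · invFact i · invFact (N ∸ i))
pascal N a = begin
  fromℕ (suc N) · ∑ (suc N) t                                          ≡⟨ ∑-*ˡ (suc N) (fromℕ (suc N)) t ⟨
  ∑[ i ≤ suc N ] (fromℕ (suc N) · t i)                                 ≡⟨ ∑-cong≤ (suc N) split ⟩
  ∑[ i ≤ suc N ] (fromℕ i · t i + fromℕ (suc N ∸ i) · t i)
      ≡⟨ ∑-+ (suc N) (λ i → fromℕ i · t i) (λ i → fromℕ (suc N ∸ i) · t i) ⟩
  ∑[ i ≤ suc N ] (fromℕ i · t i) + ∑[ i ≤ suc N ] (fromℕ (suc N ∸ i) · t i) ≡⟨ cong₂ _+_ lower upper ⟩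
  ∑[ i ≤ N ] (a (suc i) · invFact i · invFact (N ∸ i)) + ∑[ i ≤ N ] (a i · invFact i · invFact (N ∸ i)) ∎
  where
  open ≡-Reasoning
  t : ℕ → ℚ
  t i = a i · invFact i · invFact (suc N ∸ i)
  split : ∀ i → i ≤ suc N → fromℕ (suc N) · t i ≡ fromℕ i · t i + fromℕ (suc N ∸ i) · t i
  split i i≤1+N = trans (cong (_· t i) (fromℕ-∸ i≤1+N)) (*-distribʳ-+ (t i) (fromℕ i) (fromℕ (suc N ∸ i)))
  absorb : ∀ n a f g → n · (a · f · g) ≡ a · (f · n) · g
  absorb = solve-∀ ℚ-ring
  lower : ∑[ i ≤ suc N ] (fromℕ i · t i) ≡ ∑[ i ≤ N ] (a (suc i) · invFact i · invFact (N ∸ i))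
  lower = begin
    0ℚ · t 0 + s                           ≡⟨ cong (_+ s) (*-zeroˡ (t 0)) ⟩
    0ℚ + s                                 ≡⟨ +-identityˡ s ⟩
    s                                      ≡⟨ ∑-cong N shift ⟩
    ∑[ i ≤ N ] (a (suc i) · invFact i · invFact (N ∸ i)) ∎
    where
    s = ∑[ i ≤ N ] (fromℕ (suc i) · t (suc i))
    shift : ∀ i → fromℕ (suc i) · t (suc i) ≡ a (suc i) · invFact i · invFact (N ∸ i)
    shift i = trans (absorb (fromℕ (suc i)) (a (suc i)) (invFact (suc i)) (invFact (N ∸ i)))
                    (cong (λ f → a (suc i) · f · invFact (N ∸ i)) (invFact-suc i))
  upper : ∑[ i ≤ suc N ] (fromℕ (suc N ∸ i) · t i) ≡ ∑[ i ≤ N ] (a i · invFact i · invFact (N ∸ i))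
  upper = begin
    ∑[ i ≤ suc N ] (fromℕ (suc N ∸ i) · t i) ≡⟨ ∑-last N (λ i → fromℕ (suc N ∸ i) · t i) ⟩
    s + fromℕ (N ∸ N) · t (suc N)            ≡⟨ cong (λ k → s + fromℕ k · t (suc N)) (ℕ.n∸n≡0 N) ⟩
    s + 0ℚ · t (suc N)                       ≡⟨ cong (s +_) (*-zeroˡ (t (suc N))) ⟩
    s + 0ℚ                                   ≡⟨ +-identityʳ s ⟩
    s                                        ≡⟨ ∑-cong≤ N middle ⟩
    ∑[ i ≤ N ] (a i · invFact i · invFact (N ∸ i)) ∎
    where
    s = ∑[ i ≤ N ] (fromℕ (suc N ∸ i) · t i)
    absorbʳ : ∀ n a f g → n · (a · f · g) ≡ a · f · (g · n)
    absorbʳ = solve-∀ ℚ-ring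
    middle : ∀ i → i ≤ N → fromℕ (suc N ∸ i) · t i ≡ a i · invFact i · invFact (N ∸ i)
    middle i i≤N = begin
      fromℕ (suc N ∸ i) · t i
          ≡⟨ cong (λ k → fromℕ k · (a i · invFact i · invFact k)) (ℕ.+-∸-assoc 1 i≤N) ⟩
      fromℕ (suc (N ∸ i)) · (a i · invFact i · invFact (suc (N ∸ i)))
          ≡⟨ absorbʳ (fromℕ (suc (N ∸ i))) (a i) (invFact i) (invFact (suc (N ∸ i))) ⟩
      a i · invFact i · (invFact (suc (N ∸ i)) · fromℕ (suc (N ∸ i)))          ≡⟨ cong (a i · invFact i ·_) (invFact-suc (N ∸ i)) ⟩
      a i · invFact i · invFact (N ∸ i)                                        ∎

weight : ℕ → ℕ → ℚ
weight ω j = sign j · invFact j · invFact (ω ∸ j)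

∑-weight≡0 : ∀ N → ∑ (suc N) (weight (suc N)) ≡ 0ℚ
∑-weight≡0 N = *-cancelˡ-≢0 (fromℕ[1+n]≢0 N) (begin
  fromℕ (suc N) · ∑ (suc N) (weight (suc N))      ≡⟨ pascal N sign ⟩
  ∑[ i ≤ N ] (sign (suc i) · invFact i · invFact (N ∸ i)) + ∑ N (weight N)
                                                  ≡⟨ cong (_+ ∑ N (weight N)) (trans (∑-cong N flip) (∑-neg N (weight N))) ⟩
  - ∑ N (weight N) + ∑ N (weight N)               ≡⟨ +-inverseˡ (∑ N (weight N)) ⟩
  0ℚ                                              ≡⟨ *-zeroʳ (fromℕ (suc N)) ⟨
  fromℕ (suc N) · 0ℚ                              ∎)
  where
  open ≡-Reasoning
  flip : ∀ i → sign (suc i) · invFact i · invFact (N ∸ i) ≡ - weight N i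
  flip i = trans (cong (λ s → s · invFact i · invFact (N ∸ i)) (sign-suc i))
                 (neg-out (sign i) (invFact i) (invFact (N ∸ i)))
    where
    neg-out : ∀ s a b → - s · a · b ≡ - (s · a · b)
    neg-out = solve-∀ ℚ-ring

∑-weight·x·f : ∀ N (f : ℚ → ℚ) →
  ∑[ j ≤ suc N ] (weight (suc N) j · (fromℕ j · f (fromℕ j))) ≡ - ∑[ i ≤ N ] (weight N i · f (fromℕ i + 1ℚ))
∑-weight·x·f N f = begin
  weight (suc N) 0 · (0ℚ · f 0ℚ) + ∑[ i ≤ N ] t (suc i)     ≡⟨ cong (_+ ∑[ i ≤ N ] t (suc i)) (first-term≡0 (weight (suc N) 0) (f 0ℚ)) ⟩
  0ℚ + ∑[ i ≤ N ] t (suc i)                                  ≡⟨ +-identityˡ (∑[ i ≤ N ] t (suc i)) ⟩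
  ∑[ i ≤ N ] t (suc i)                                       ≡⟨ ∑-cong N absorb ⟩
  ∑[ i ≤ N ] (- (weight N i · f (fromℕ i + 1ℚ)))             ≡⟨ ∑-neg N (λ i → weight N i · f (fromℕ i + 1ℚ)) ⟩
  - ∑[ i ≤ N ] (weight N i · f (fromℕ i + 1ℚ))               ∎
  where
  open ≡-Reasoning
  t : ℕ → ℚ
  t j = weight (suc N) j · (fromℕ j · f (fromℕ j))
  first-term≡0 : ∀ w y → w · (0ℚ · y) ≡ 0ℚ
  first-term≡0 = solve-∀ ℚ-ring
  regroup : ∀ s g h n y → - s · g · h · (n · y) ≡ - (s · (g · n) · h · y)
  regroup = solve-∀ ℚ-ring
  absorb : ∀ i → t (suc i) ≡ - (weight N i · f (fromℕ i + 1ℚ))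
  absorb i = begin
    sign (suc i) · invFact (suc i) · invFact (N ∸ i) · (fromℕ (suc i) · f (fromℕ (suc i)))
        ≡⟨ cong₂ (λ s y → s · invFact (suc i) · invFact (N ∸ i) · (fromℕ (suc i) · f y)) (sign-suc i) (fromℕ-suc i) ⟩
    - sign i · invFact (suc i) · invFact (N ∸ i) · (fromℕ (suc i) · f (fromℕ i + 1ℚ))
        ≡⟨ regroup (sign i) (invFact (suc i)) (invFact (N ∸ i)) (fromℕ (suc i)) (f (fromℕ i + 1ℚ)) ⟩
    - (sign i · (invFact (suc i) · fromℕ (suc i)) · invFact (N ∸ i) · f (fromℕ i + 1ℚ))
        ≡⟨ cong (λ g → - (sign i · g · invFact (N ∸ i) · f (fromℕ i + 1ℚ))) (invFact-suc i) ⟩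
    - (weight N i · f (fromℕ i + 1ℚ)) ∎

-- The sum is an ω-th finite difference.
∑-weight·poly≡0 : ∀ d {R} → Degree≤ d R → ∀ ω → d ℕ.< ω → ∑[ j ≤ ω ] (weight ω j · R (fromℕ j)) ≡ 0ℚ
∑-weight·poly≡0 zero {R} R-const (suc N) _ = begin
  ∑[ j ≤ suc N ] (weight (suc N) j · R (fromℕ j))
      ≡⟨ ∑-cong (suc N) (λ j → trans (cong (weight (suc N) j ·_) (R-const (fromℕ j))) (*-comm (weight (suc N) j) (R 0ℚ))) ⟩
  ∑[ j ≤ suc N ] (R 0ℚ · weight (suc N) j)         ≡⟨ ∑-*ˡ (suc N) (R 0ℚ) (weight (suc N)) ⟩
  R 0ℚ · ∑ (suc N) (weight (suc N))                ≡⟨ cong (R 0ℚ ·_) (∑-weight≡0 N) ⟩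
  R 0ℚ · 0ℚ                                        ≡⟨ *-zeroʳ (R 0ℚ) ⟩
  0ℚ                                               ∎
  where open ≡-Reasoning
∑-weight·poly≡0 (suc d) {R} (T , T-deg , R≡) ω@(suc (suc N)) (s≤s d<1+N) = begin
  ∑[ j ≤ ω ] (weight ω j · R (fromℕ j))
      ≡⟨ ∑-cong ω (λ j → trans (cong (weight ω j ·_) (R≡ (fromℕ j))) (*-distribˡ-+ (weight ω j) (R 0ℚ) (fromℕ j · T (fromℕ j)))) ⟩
  ∑[ j ≤ ω ] (weight ω j · R 0ℚ + weight ω j · (fromℕ j · T (fromℕ j)))
      ≡⟨ ∑-+ ω (λ j → weight ω j · R 0ℚ) (λ j → weight ω j · (fromℕ j · T (fromℕ j))) ⟩
  ∑[ j ≤ ω ] (weight ω j · R 0ℚ) + ∑[ j ≤ ω ] (weight ω j · (fromℕ j · T (fromℕ j)))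
        ≡⟨ cong₂ _+_ (∑-weight·poly≡0 0 (Degree≤-const 0 (R 0ℚ)) ω (s≤s z≤n)) (∑-weight·x·f (suc N) T) ⟩
  0ℚ + - ∑[ i ≤ suc N ] (weight (suc N) i · T (fromℕ i + 1ℚ))
        ≡⟨ cong (λ s → 0ℚ + - s) (∑-weight·poly≡0 d (Degree≤-translate d 1ℚ T-deg) (suc N) d<1+N) ⟩
  0ℚ + - 0ℚ                                                               ≡⟨⟩
  0ℚ                                                                      ∎
  where open ≡-Reasoning

rising : ℚ → ℕ → ℚ
rising x zero    = 1ℚ
rising x (suc n) = rising x n · (x + fromℕ n)

rising-suc′ : ∀ x n → rising x (suc n) ≡ x · rising (x + 1ℚ) n
rising-suc′ x zero    = trans (*-identityˡ (x + 0ℚ)) (trans (+-identityʳ x) (sym (*-identityʳ x)))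
rising-suc′ x (suc n) = begin
  rising x (suc n) · (x + fromℕ (suc n))          ≡⟨ cong₂ (λ r m → r · (x + m)) (rising-suc′ x n) (fromℕ-suc n) ⟩
  x · rising (x + 1ℚ) n · (x + (fromℕ n + 1ℚ))    ≡⟨ regroup x (rising (x + 1ℚ) n) (fromℕ n) ⟩
  x · (rising (x + 1ℚ) n · (x + 1ℚ + fromℕ n))    ∎
  where
  open ≡-Reasoning
  regroup : ∀ x r m → x · r · (x + (m + 1ℚ)) ≡ x · (r · (x + 1ℚ + m))
  regroup = solve-∀ ℚ-ring

3/2 : ℚ
3/2 = 1ℚ + ½

fromℕ-odd : ∀ m → fromℕ (3 ℕ.+ 2 * m) ≡ fromℕ 2 · (fromℕ m + 3/2)
fromℕ-odd m = trans (fromℕ-homo-+ 3 (2 * m)) (trans (cong (fromℕ 3 +_) (fromℕ-homo-* 2 m)) (factor (fromℕ m)))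
  where
  factor : ∀ x → fromℕ 3 + fromℕ 2 · x ≡ fromℕ 2 · (x + 3/2)
  factor = solve-∀ ℚ-ring

1/ℕ-odd : ∀ m → 1/ℕ (3 ℕ.+ 2 * m) · (fromℕ m + 3/2) ≡ ½
1/ℕ-odd m = begin
  r · (fromℕ m + 3/2)                        ≡⟨ double-halve r (fromℕ m + 3/2) ⟩
  r · (fromℕ 2 · (fromℕ m + 3/2)) · ½        ≡⟨ cong (λ t → r · t · ½) (fromℕ-odd m) ⟨
  r · fromℕ (3 ℕ.+ 2 * m) · ½              ≡⟨ cong (_· ½) (1/ℕ-inverseˡ (3 ℕ.+ 2 * m)) ⟩
  1ℚ · ½                                     ≡⟨⟩
  ½                                          ∎
  where
  open ≡-Reasoning
  r = 1/ℕ (3 ℕ.+ 2 * m)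
  double-halve : ∀ r y → r · y ≡ r · (fromℕ 2 · y) · ½
  double-halve = solve-∀ ℚ-ring

-- β N k = ∑ᵢ (-1)ⁱ / (i! (N-i)! (2(k+i)+3)); the partial-fraction expansion of 1 / (2 (x)_(N+1)) at x = k + 3/2.
β : ℕ → ℕ → ℚ
β N k = ∑[ i ≤ N ] (sign i · 1/ℕ (3 ℕ.+ 2 * (k ℕ.+ i)) · invFact i · invFact (N ∸ i))

β-pascal : ∀ N k → fromℕ (suc N) · β (suc N) k ≡ - β N (suc k) + β N k
β-pascal N k = trans (pascal N (λ i → sign i · 1/ℕ (3 ℕ.+ 2 * (k ℕ.+ i))))
  (cong (_+ β N k) (trans (∑-cong N flip) (∑-neg N (λ i → sign i · 1/ℕ (3 ℕ.+ 2 * (suc k ℕ.+ i)) · invFact i · invFact (N ∸ i)))))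
  where
  neg-out : ∀ s r a b → - s · r · a · b ≡ - (s · r · a · b)
  neg-out = solve-∀ ℚ-ring
  flip : ∀ i → sign (suc i) · 1/ℕ (3 ℕ.+ 2 * (k ℕ.+ suc i)) · invFact i · invFact (N ∸ i)
             ≡ - (sign i · 1/ℕ (3 ℕ.+ 2 * (suc k ℕ.+ i)) · invFact i · invFact (N ∸ i))
  flip i = trans (cong₂ (λ s m → s · 1/ℕ (3 ℕ.+ 2 * m) · invFact i · invFact (N ∸ i)) (sign-suc i) (ℕ.+-suc k i))
                 (neg-out (sign i) (1/ℕ (3 ℕ.+ 2 * (suc k ℕ.+ i))) (invFact i) (invFact (N ∸ i)))

β-rising : ∀ N k → fromℕ 2 · β N k · rising (fromℕ k + 3/2) (suc N) ≡ 1ℚ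
β-rising zero k = begin
  fromℕ 2 · (1ℚ · r · 1ℚ · 1ℚ) · (1ℚ · (fromℕ k + 3/2 + 0ℚ))  ≡⟨ simplify r (fromℕ k + 3/2) ⟩
  fromℕ 2 · (r · (fromℕ k + 3/2))
      ≡⟨ cong (λ m → fromℕ 2 · (1/ℕ (3 ℕ.+ 2 * m) · (fromℕ k + 3/2))) (ℕ.+-identityʳ k) ⟩
  fromℕ 2 · (1/ℕ (3 ℕ.+ 2 * k) · (fromℕ k + 3/2))            ≡⟨ cong (fromℕ 2 ·_) (1/ℕ-odd k) ⟩
  fromℕ 2 · ½                                                  ≡⟨⟩
  1ℚ                                                           ∎
  where
  open ≡-Reasoning
  r = 1/ℕ (3 ℕ.+ 2 * (k ℕ.+ 0))
  simplify : ∀ r y → fromℕ 2 · (1ℚ · r · 1ℚ · 1ℚ) · (1ℚ · (y + 0ℚ)) ≡ fromℕ 2 · (r · y)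
  simplify = solve-∀ ℚ-ring
β-rising (suc N) k = *-cancelˡ-≢0 (fromℕ[1+n]≢0 N) (begin
  n · (fromℕ 2 · β (suc N) k · rising x (suc (suc N)))                 ≡⟨ pull-n n (fromℕ 2) (β (suc N) k) (rising x (suc (suc N))) ⟩
  fromℕ 2 · (n · β (suc N) k) · rising x (suc (suc N))                 ≡⟨ cong (λ t → fromℕ 2 · t · rising x (suc (suc N))) (β-pascal N k) ⟩
  fromℕ 2 · (- B + A) · rising x (suc (suc N))                         ≡⟨ distrib (fromℕ 2) A B (rising x (suc (suc N))) ⟩
  fromℕ 2 · A · rising x (suc (suc N)) - fromℕ 2 · B · rising x (suc (suc N))
      ≡⟨ cong₂ (λ u v → fromℕ 2 · A · u - fromℕ 2 · B · v) refl (rising-suc′ x (suc N)) ⟩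
  fromℕ 2 · A · (rising x (suc N) · (x + n)) - fromℕ 2 · B · (x · rising (x + 1ℚ) (suc N))
      ≡⟨ regroup (fromℕ 2) A B (rising x (suc N)) (rising (x + 1ℚ) (suc N)) x n ⟩
  fromℕ 2 · A · rising x (suc N) · (x + n) - x · (fromℕ 2 · B · rising (x + 1ℚ) (suc N))
      ≡⟨ cong₂ (λ u v → u · (x + n) - x · (fromℕ 2 · B · rising v (suc N))) (β-rising N k) x+1≡ ⟩
  1ℚ · (x + n) - x · (fromℕ 2 · B · rising (fromℕ (suc k) + 3/2) (suc N))
      ≡⟨ cong (λ u → 1ℚ · (x + n) - x · u) (β-rising N (suc k)) ⟩
  1ℚ · (x + n) - x · 1ℚ                                                ≡⟨ cancel-x x n ⟩
  n · 1ℚ                                                               ∎)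
  where
  open ≡-Reasoning
  n = fromℕ (suc N)
  x = fromℕ k + 3/2
  A = β N k
  B = β N (suc k)
  swap : ∀ a b c → a + b + c ≡ a + c + b
  swap = solve-∀ ℚ-ring
  x+1≡ : x + 1ℚ ≡ fromℕ (suc k) + 3/2
  x+1≡ = trans (swap (fromℕ k) 3/2 1ℚ) (cong (_+ 3/2) (sym (fromℕ-suc k)))
  pull-n : ∀ n t b r → n · (t · b · r) ≡ t · (n · b) · r
  pull-n = solve-∀ ℚ-ring
  distrib : ∀ t a b r → t · (- b + a) · r ≡ t · a · r - t · b · r
  distrib = solve-∀ ℚ-ring
  regroup : ∀ t a b p q x n → t · a · (p · (x + n)) - t · b · (x · q) ≡ t · a · p · (x + n) - x · (t · b · q)
  regroup = solve-∀ ℚ-ring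
  cancel-x : ∀ x n → 1ℚ · (x + n) - x · 1ℚ ≡ n · 1ℚ
  cancel-x = solve-∀ ℚ-ring

Degree≤-factor : ∀ d {P} → Degree≤ (suc d) P → ∀ a →
  Σ[ R ∈ (ℚ → ℚ) ] Degree≤ d R × (∀ x → P x ≡ P a + (x - a) · R x)
Degree≤-factor d {P} P-deg a = factor (Degree≤-translate (suc d) a P-deg)
  where
  x-a+a≡x : ∀ x a → x - a + a ≡ x
  x-a+a≡x = solve-∀ ℚ-ring
  factor : Degree≤ (suc d) (λ y → P (y + a)) → Σ[ R ∈ (ℚ → ℚ) ] Degree≤ d R × (∀ x → P x ≡ P a + (x - a) · R x)
  factor (R , R-deg , P[y+a]≡) = (λ x → R (x - a)) , Degree≤-translate d (- a) R-deg , λ x →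
    trans (cong P (sym (x-a+a≡x x a)))
          (trans (P[y+a]≡ (x - a)) (cong (λ y → P y + (x - a) · R (x - a)) (+-identityˡ a)))

∑-weight/odd≡β : ∀ ω → ∑[ j ≤ ω ] (weight ω j · 1/ℕ (3 ℕ.+ 2 * j)) ≡ β ω 0
∑-weight/odd≡β ω = ∑-cong ω (λ j → reorder (sign j) (invFact j) (invFact (ω ∸ j)) (1/ℕ (3 ℕ.+ 2 * j)))
  where
  reorder : ∀ s f g r → s · f · g · r ≡ s · r · f · g
  reorder = solve-∀ ℚ-ring

-- Divide P by x + 3/2: the quotient is annihilated by the weights, and (j + 3/2) / (2j + 3) = 1/2.
∑-weight/odd·poly : ∀ d {P} → Degree≤ d P → ∀ ω → d ≤ ω →
  ∑[ j ≤ ω ] (weight ω j · 1/ℕ (3 ℕ.+ 2 * j) · P (fromℕ j)) ≡ P (- 3/2) · β ω 0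
∑-weight/odd·poly zero {P} P-const ω _ = begin
  ∑[ j ≤ ω ] (b j · P (fromℕ j))
      ≡⟨ ∑-cong ω (λ j → trans (cong (b j ·_) (trans (P-const (fromℕ j)) (sym (P-const (- 3/2))))) (*-comm (b j) (P (- 3/2)))) ⟩
  ∑[ j ≤ ω ] (P (- 3/2) · b j)     ≡⟨ ∑-*ˡ ω (P (- 3/2)) b ⟩
  P (- 3/2) · ∑ ω b                ≡⟨ cong (P (- 3/2) ·_) (∑-weight/odd≡β ω) ⟩
  P (- 3/2) · β ω 0                ∎
  where
  open ≡-Reasoning
  b : ℕ → ℚ
  b j = weight ω j · 1/ℕ (3 ℕ.+ 2 * j)
∑-weight/odd·poly (suc d) {P} P-deg ω d<ω = begin
  ∑[ j ≤ ω ] (b j · P (fromℕ j))                                        ≡⟨ ∑-cong ω term ⟩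
  ∑[ j ≤ ω ] (P (- 3/2) · b j + ½ · (weight ω j · R (fromℕ j)))
      ≡⟨ ∑-+ ω (λ j → P (- 3/2) · b j) (λ j → ½ · (weight ω j · R (fromℕ j))) ⟩
  ∑[ j ≤ ω ] (P (- 3/2) · b j) + ∑[ j ≤ ω ] (½ · (weight ω j · R (fromℕ j)))
      ≡⟨ cong₂ _+_ (∑-*ˡ ω (P (- 3/2)) b) (∑-*ˡ ω ½ (λ j → weight ω j · R (fromℕ j))) ⟩
  P (- 3/2) · ∑ ω b + ½ · ∑[ j ≤ ω ] (weight ω j · R (fromℕ j))
      ≡⟨ cong₂ (λ s t → P (- 3/2) · s + ½ · t) (∑-weight/odd≡β ω) (∑-weight·poly≡0 d R-deg ω d<ω) ⟩
  P (- 3/2) · β ω 0 + ½ · 0ℚ                                           ≡⟨ +-identityʳ (P (- 3/2) · β ω 0) ⟩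
  P (- 3/2) · β ω 0                                                    ∎
  where
  open ≡-Reasoning
  R : ℚ → ℚ
  R = proj₁ (Degree≤-factor d P-deg (- 3/2))
  R-deg : Degree≤ d R
  R-deg = proj₁ (proj₂ (Degree≤-factor d P-deg (- 3/2)))
  P≡ : ∀ x → P x ≡ P (- 3/2) + (x - - 3/2) · R x
  P≡ = proj₂ (proj₂ (Degree≤-factor d P-deg (- 3/2)))
  expand : ∀ w r p y q → w · r · (p + y · q) ≡ p · (w · r) + r · y · (w · q)
  expand = solve-∀ ℚ-ring
  y+3/2 : ∀ y → y - - 3/2 ≡ y + 3/2
  y+3/2 = solve-∀ ℚ-ring
  r : ℕ → ℚ
  r j = 1/ℕ (3 ℕ.+ 2 * j)
  b : ℕ → ℚ
  b j = weight ω j · r j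
  term : ∀ j → b j · P (fromℕ j) ≡ P (- 3/2) · b j + ½ · (weight ω j · R (fromℕ j))
  term j = begin
    b j · P (fromℕ j)    ≡⟨ cong (b j ·_) (P≡ (fromℕ j)) ⟩
    b j · (P (- 3/2) + (fromℕ j - - 3/2) · R (fromℕ j))
        ≡⟨ expand (weight ω j) (r j) (P (- 3/2)) (fromℕ j - - 3/2) (R (fromℕ j)) ⟩
    P (- 3/2) · b j + r j · (fromℕ j - - 3/2) · (weight ω j · R (fromℕ j))
        ≡⟨ cong (λ t → P (- 3/2) · b j + t · (weight ω j · R (fromℕ j))) (trans (cong (r j ·_) (y+3/2 (fromℕ j))) (1/ℕ-odd j)) ⟩
    P (- 3/2) · b j + ½ · (weight ω j · R (fromℕ j)) ∎

-- ∑ₗ C(2m, m+l) g l / (2m)!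
centralSum : (ℕ → ℚ) → ℕ → ℚ
centralSum g m = ∑[ l ≤ m ] (g l · invFact (m ℕ.+ l) · invFact (m ∸ l))

centralSum-cong : ∀ m {f g} → (∀ l → f l ≡ g l) → centralSum f m ≡ centralSum g m
centralSum-cong m f≗g = ∑-cong m (λ l → cong (λ z → z · invFact (m ℕ.+ l) · invFact (m ∸ l)) (f≗g l))

centralSum-linear : ∀ m a b f g → centralSum (λ l → a · f l + b · g l) m ≡ a · centralSum f m + b · centralSum g m
centralSum-linear m a b f g =
  trans (∑-cong m (λ l → distrib a b (f l) (g l) (invFact (m ℕ.+ l)) (invFact (m ∸ l))))
        (trans (∑-+ m _ _) (cong₂ _+_ (∑-*ˡ m a _) (∑-*ˡ m b _)))
  where
  distrib : ∀ a b x y p q → (a · x + b · y) · p · q ≡ a · (x · p · q) + b · (y · p · q)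
  distrib = solve-∀ ℚ-ring

l²-[1+m]² : ∀ {m l} → l ≤ m → fromℕ (l * l) - fromℕ (suc m * suc m) ≡ - (fromℕ (suc (m ℕ.+ l)) · fromℕ (suc (m ∸ l)))
l²-[1+m]² {m} {l} l≤m = begin
  fromℕ (l * l) - fromℕ (suc m * suc m)                        ≡⟨ cong (λ t → fromℕ (l * l) - fromℕ t) (sym ℕ-identity) ⟩
  fromℕ (l * l) - fromℕ (l * l ℕ.+ suc (m ℕ.+ l) * suc (m ∸ l))
      ≡⟨ cong (λ t → fromℕ (l * l) - t) (trans (fromℕ-homo-+ (l * l) _) (cong (fromℕ (l * l) +_) (fromℕ-homo-* (suc (m ℕ.+ l)) (suc (m ∸ l))))) ⟩
  fromℕ (l * l) - (fromℕ (l * l) + fromℕ (suc (m ℕ.+ l)) · fromℕ (suc (m ∸ l)))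
      ≡⟨ cancel (fromℕ (l * l)) (fromℕ (suc (m ℕ.+ l)) · fromℕ (suc (m ∸ l))) ⟩
  - (fromℕ (suc (m ℕ.+ l)) · fromℕ (suc (m ∸ l)))                  ∎
  where
  open ≡-Reasoning
  cancel : ∀ x y → x - (x + y) ≡ - y
  cancel = solve-∀ ℚ-ring
  identity : ∀ l d → l * l ℕ.+ suc (l ℕ.+ d ℕ.+ l) * suc d ≡ suc (l ℕ.+ d) * suc (l ℕ.+ d)
  identity = ℕ-Solver.solve-∀
  ℕ-identity : l * l ℕ.+ suc (m ℕ.+ l) * suc (m ∸ l) ≡ suc m * suc m
  ℕ-identity = subst (λ k → l * l ℕ.+ suc (k ℕ.+ l) * suc (m ∸ l) ≡ suc k * suc k)
                     (ℕ.m+[n∸m]≡n l≤m) (identity l (m ∸ l))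

-- The factor l² - (m+1)² is -(m+1+l)(m+1-l), which cancels against the factorials; the term l = m+1 vanishes.
centralSum-shift : ∀ m g → centralSum (λ l → (fromℕ (l * l) - fromℕ (suc m * suc m)) · g l) (suc m) ≡ - centralSum g m
centralSum-shift m g = begin
  ∑ (suc m) t                          ≡⟨ ∑-last m t ⟩
  ∑ m t + t (suc m)                    ≡⟨ cong₂ _+_ (∑-cong≤ m inner) last≡0 ⟩
  ∑[ l ≤ m ] (- u l) + 0ℚ              ≡⟨ +-identityʳ (∑[ l ≤ m ] (- u l)) ⟩
  ∑[ l ≤ m ] (- u l)                   ≡⟨ ∑-neg m u ⟩
  - centralSum g m                     ∎
  where
  open ≡-Reasoning
  zero-left : ∀ a b c → 0ℚ · a · b · c ≡ 0ℚ
  zero-left = solve-∀ ℚ-ring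
  absorb : ∀ a b x p q → - (a · b) · x · p · q ≡ - (x · (p · a) · (q · b))
  absorb = solve-∀ ℚ-ring
  M = suc m
  t : ℕ → ℚ
  t l = (fromℕ (l * l) - fromℕ (M * M)) · g l · invFact (M ℕ.+ l) · invFact (M ∸ l)
  u : ℕ → ℚ
  u l = g l · invFact (m ℕ.+ l) · invFact (m ∸ l)
  last≡0 : t M ≡ 0ℚ
  last≡0 = trans (cong (λ z → z · g M · invFact (M ℕ.+ M) · invFact (M ∸ M)) (+-inverseʳ (fromℕ (M * M))))
                 (zero-left (g M) (invFact (M ℕ.+ M)) (invFact (M ∸ M)))
  inner : ∀ l → l ≤ m → t l ≡ - u l
  inner l l≤m = begin
    t l    ≡⟨ cong₂ (λ z k → z · g l · invFact (suc (m ℕ.+ l)) · invFact k) (l²-[1+m]² l≤m) (ℕ.+-∸-assoc 1 l≤m) ⟩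
    - (fromℕ (suc (m ℕ.+ l)) · fromℕ (suc (m ∸ l))) · g l · invFact (suc (m ℕ.+ l)) · invFact (suc (m ∸ l))
       ≡⟨ absorb (fromℕ (suc (m ℕ.+ l))) (fromℕ (suc (m ∸ l))) (g l) (invFact (suc (m ℕ.+ l))) (invFact (suc (m ∸ l))) ⟩
    - (g l · (invFact (suc (m ℕ.+ l)) · fromℕ (suc (m ℕ.+ l))) · (invFact (suc (m ∸ l)) · fromℕ (suc (m ∸ l))))
       ≡⟨ cong₂ (λ p q → - (g l · p · q)) (invFact-suc (m ℕ.+ l)) (invFact-suc (m ∸ l)) ⟩
    - u l  ∎

-- Telescoping terms for centralSum sign (m + 1).
alternatingTail : ℕ → ℕ → ℚ
alternatingTail m l = sign l · invFact (m ℕ.+ l) · invFact (suc m ∸ l)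

alternatingTail-difference : ∀ m l → l ≤ m →
  fromℕ (2 * suc m) · (sign l · invFact (suc m ℕ.+ l) · invFact (suc m ∸ l)) ≡ alternatingTail m l - alternatingTail m (suc l)
alternatingTail-difference m l l≤m = begin
  fromℕ (2 * suc m) · (sign l · invFact (suc (m ℕ.+ l)) · invFact (suc m ∸ l))
      ≡⟨ cong₂ (λ c k → c · (sign l · invFact (suc (m ℕ.+ l)) · invFact k)) 2[1+m]≡ (ℕ.+-∸-assoc 1 l≤m) ⟩
  (a + b) · (sign l · invFact (suc (m ℕ.+ l)) · invFact (suc (m ∸ l)))
      ≡⟨ split a b (sign l) (invFact (suc (m ℕ.+ l))) (invFact (suc (m ∸ l))) ⟩
  sign l · (invFact (suc (m ℕ.+ l)) · a) · invFact (suc (m ∸ l)) - - sign l · invFact (suc (m ℕ.+ l)) · (invFact (suc (m ∸ l)) · b)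
      ≡⟨ cong₂ (λ p q → sign l · p · invFact (suc (m ∸ l)) - - sign l · invFact (suc (m ℕ.+ l)) · q) (invFact-suc (m ℕ.+ l)) (invFact-suc (m ∸ l)) ⟩
  sign l · invFact (m ℕ.+ l) · invFact (suc (m ∸ l)) - - sign l · invFact (suc (m ℕ.+ l)) · invFact (m ∸ l)
      ≡⟨ cong₃ (λ k s i → sign l · invFact (m ℕ.+ l) · invFact k - s · invFact i · invFact (m ∸ l))
               (sym (ℕ.+-∸-assoc 1 l≤m)) (sym (sign-suc l)) (sym (ℕ.+-suc m l)) ⟩
  alternatingTail m l - alternatingTail m (suc l) ∎
  where
  open ≡-Reasoning
  split : ∀ a b s f g → (a + b) · (s · f · g) ≡ s · (f · a) · g - - s · f · (g · b)
  split = solve-∀ ℚ-ring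
  identity : ∀ l d → 2 * suc (l ℕ.+ d) ≡ suc (l ℕ.+ d ℕ.+ l) ℕ.+ suc d
  identity = ℕ-Solver.solve-∀
  a = fromℕ (suc (m ℕ.+ l))
  b = fromℕ (suc (m ∸ l))
  2[1+m]≡ : fromℕ (2 * suc m) ≡ a + b
  2[1+m]≡ = trans (cong fromℕ (subst (λ k → 2 * suc k ≡ suc (k ℕ.+ l) ℕ.+ suc (m ∸ l)) (ℕ.m+[n∸m]≡n l≤m) (identity l (m ∸ l))))
                  (fromℕ-homo-+ (suc (m ℕ.+ l)) (suc (m ∸ l)))

alternatingTail-last : ∀ m → fromℕ (2 * suc m) · (sign (suc m) · invFact (suc m ℕ.+ suc m) · invFact (suc m ∸ suc m)) ≡ alternatingTail m (suc m)
alternatingTail-last m = begin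
  fromℕ (2 * M) · (sign M · invFact (M ℕ.+ M) · invFact (M ∸ M))
      ≡⟨ cong₂ (λ c k → c · (sign M · invFact (M ℕ.+ M) · invFact k)) (cong fromℕ (2M≡M+M m)) (ℕ.n∸n≡0 M) ⟩
  fromℕ (suc (m ℕ.+ M)) · (sign M · invFact (suc (m ℕ.+ M)) · 1ℚ)
      ≡⟨ regroup (fromℕ (suc (m ℕ.+ M))) (sign M) (invFact (suc (m ℕ.+ M))) ⟩
  sign M · (invFact (suc (m ℕ.+ M)) · fromℕ (suc (m ℕ.+ M))) · 1ℚ
      ≡⟨ cong₂ (λ f k → sign M · f · invFact k) (invFact-suc (m ℕ.+ M)) (sym (ℕ.n∸n≡0 M)) ⟩
  alternatingTail m M ∎
  where
  open ≡-Reasoning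
  regroup : ∀ a s f → a · (s · f · 1ℚ) ≡ s · (f · a) · 1ℚ
  regroup = solve-∀ ℚ-ring
  2M≡M+M : ∀ m → 2 * suc m ≡ suc (m ℕ.+ suc m)
  2M≡M+M = ℕ-Solver.solve-∀
  M = suc m

centralSum-sign : ∀ m → centralSum sign (suc m) ≡ ½ · (invFact (suc m) · invFact (suc m))
centralSum-sign m = begin
  centralSum sign M                        ≡⟨ halve (centralSum sign M) ⟩
  ½ · (fromℕ 2 · centralSum sign M)
      ≡⟨ cong (½ ·_) (*-cancelˡ-≢0 {b = fromℕ 2 · centralSum sign M} {c = invFact M · invFact M} (fromℕ[1+n]≢0 m) doubled) ⟩
  ½ · (invFact M · invFact M)              ∎
  where
  open ≡-Reasoning
  halve : ∀ x → x ≡ ½ · (fromℕ 2 · x)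
  halve = solve-∀ ℚ-ring
  collapse : ∀ x y → x - y + y ≡ x
  collapse = solve-∀ ℚ-ring
  first-term : ∀ g n → 1ℚ · (g · n) · g ≡ n · (g · g)
  first-term = solve-∀ ℚ-ring
  reorder : ∀ m t e → m · (t · e) ≡ t · m · e
  reorder = solve-∀ ℚ-ring
  M = suc m
  A = alternatingTail m
  t : ℕ → ℚ
  t l = sign l · invFact (M ℕ.+ l) · invFact (M ∸ l)
  doubled : fromℕ M · (fromℕ 2 · centralSum sign M) ≡ fromℕ M · (invFact M · invFact M)
  doubled = begin
    fromℕ M · (fromℕ 2 · ∑ M t)                            ≡⟨ reorder (fromℕ M) (fromℕ 2) (∑ M t) ⟩
    fromℕ 2 · fromℕ M · ∑ M t                              ≡⟨ cong (_· ∑ M t) (fromℕ-homo-* 2 M) ⟨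
    fromℕ (2 * M) · ∑ M t                                  ≡⟨ ∑-*ˡ M (fromℕ (2 * M)) t ⟨
    ∑[ l ≤ M ] (fromℕ (2 * M) · t l)                       ≡⟨ ∑-last m (λ l → fromℕ (2 * M) · t l) ⟩
    ∑[ l ≤ m ] (fromℕ (2 * M) · t l) + fromℕ (2 * M) · t M
        ≡⟨ cong₂ _+_ (∑-cong≤ m (alternatingTail-difference m)) (alternatingTail-last m) ⟩
    ∑[ l ≤ m ] (A l - A (suc l)) + A M                     ≡⟨ cong (_+ A M) (∑-telescope m A) ⟩
    A 0 - A M + A M                                        ≡⟨ collapse (A 0) (A M) ⟩
    1ℚ · invFact (m ℕ.+ 0) · invFact M                     ≡⟨ cong (λ k → 1ℚ · invFact k · invFact M) (ℕ.+-identityʳ m) ⟩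
    1ℚ · invFact m · invFact M                             ≡⟨ cong (λ f → 1ℚ · f · invFact M) (invFact-suc m) ⟨
    1ℚ · (invFact M · fromℕ M) · invFact M                 ≡⟨ first-term (invFact M) (fromℕ M) ⟩
    fromℕ M · (invFact M · invFact M)                      ∎

innerTerm : ℕ → ℕ → ℚ
innerTerm N l = fromℤ (sgn l ℤ.* ℤ.+ (l * l) ℤ.* (ℤ.+ (l * l) ℤ.- ℤ.+ 1) ℤ.^ N)

innerTerm-zero : ∀ l → innerTerm 0 l ≡ sign l · fromℕ (l * l)
innerTerm-zero l = trans (fromℤ-homo-* (sgn l ℤ.* ℤ.+ (l * l)) (ℤ.+ 1))
  (trans (*-identityʳ _) (fromℤ-homo-* (sgn l) (ℤ.+ (l * l))))

innerTerm-suc : ∀ N l → innerTerm (suc N) l ≡ (fromℕ (l * l) - 1ℚ) · innerTerm N l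
innerTerm-suc N l = begin
  fromℤ (s ℤ.* (X ℤ.* X ℤ.^ N))             ≡⟨ fromℤ-homo-* s (X ℤ.* X ℤ.^ N) ⟩
  fromℤ s · fromℤ (X ℤ.* X ℤ.^ N)           ≡⟨ cong (fromℤ s ·_) (fromℤ-homo-* X (X ℤ.^ N)) ⟩
  fromℤ s · (fromℤ X · fromℤ (X ℤ.^ N))     ≡⟨ cong (λ x → fromℤ s · (x · fromℤ (X ℤ.^ N))) (fromℤ-homo-+ (ℤ.+ (l * l)) (ℤ.- ℤ.+ 1)) ⟩
  fromℤ s · ((fromℕ (l * l) - 1ℚ) · fromℤ (X ℤ.^ N))   ≡⟨ swap (fromℤ s) (fromℕ (l * l) - 1ℚ) (fromℤ (X ℤ.^ N)) ⟩
  (fromℕ (l * l) - 1ℚ) · (fromℤ s · fromℤ (X ℤ.^ N))   ≡⟨ cong ((fromℕ (l * l) - 1ℚ) ·_) (fromℤ-homo-* s (X ℤ.^ N)) ⟨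
  (fromℕ (l * l) - 1ℚ) · innerTerm N l    ∎
  where
  open ≡-Reasoning
  swap : ∀ a b c → a · (b · c) ≡ b · (a · c)
  swap = solve-∀ ℚ-ring
  s = sgn l ℤ.* ℤ.+ (l * l)
  X = ℤ.+ (l * l) ℤ.- ℤ.+ 1

inner : ℕ → ℕ → ℚ
inner N = centralSum (innerTerm N)

innerSum≡inner : ∀ n j → innerSum n j ≡ inner (j ℕ.+ n) (suc j)
innerSum≡inner n j = trans (sumTo≡∑ (suc j) term) (∑-cong (suc j) λ l →
  cong₂ (λ x k → x · invFact k · invFact (suc j ∸ l)) (/1≡fromℤ (numerator l)) (ℕ.+-comm (j ℕ.+ l) 1))
  where
  numerator : ℕ → ℤ
  numerator l = sgn l ℤ.* ℤ.+ (l * l) ℤ.* (ℤ.+ (l * l) ℤ.- ℤ.+ 1) ℤ.^ (j ℕ.+ n)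
  term : ℕ → ℚ
  term l = numerator l / 1 · invFact (j ℕ.+ l ℕ.+ 1) · invFact (suc j ∸ l)

-- Split l² - 1 = (l² - (m+1)²) + ((m+1)² - 1) and apply centralSum-shift to the first part.
inner-suc : ∀ N m → inner (suc N) (suc m) ≡ - inner N m + (fromℕ (suc m * suc m) - 1ℚ) · inner N (suc m)
inner-suc N m = begin
  centralSum (innerTerm (suc N)) M
      ≡⟨ centralSum-cong M (λ l → trans (innerTerm-suc N l) (split (fromℕ (l * l)) (fromℕ (M * M)) (innerTerm N l))) ⟩
  centralSum (λ l → 1ℚ · ((fromℕ (l * l) - fromℕ (M * M)) · innerTerm N l) + c · innerTerm N l) M
      ≡⟨ centralSum-linear M 1ℚ c (λ l → (fromℕ (l * l) - fromℕ (M * M)) · innerTerm N l) (innerTerm N) ⟩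
  1ℚ · centralSum (λ l → (fromℕ (l * l) - fromℕ (M * M)) · innerTerm N l) M + c · inner N M
      ≡⟨ cong (λ z → 1ℚ · z + c · inner N M) (centralSum-shift m (innerTerm N)) ⟩
  1ℚ · - inner N m + c · inner N M
      ≡⟨ cong (_+ c · inner N M) (*-identityˡ (- inner N m)) ⟩
  - inner N m + c · inner N M ∎
  where
  open ≡-Reasoning
  split : ∀ x y g → (x - 1ℚ) · g ≡ 1ℚ · ((x - y) · g) + (y - 1ℚ) · g
  split = solve-∀ ℚ-ring
  M = suc m
  c = fromℕ (M * M) - 1ℚ

inner-zero-vanishes : ∀ m → inner 0 (suc (suc m)) ≡ 0ℚ
inner-zero-vanishes m = begin
  centralSum (innerTerm 0) M
      ≡⟨ centralSum-cong M (λ l → trans (innerTerm-zero l) (split (sign l) (fromℕ (l * l)) c)) ⟩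
  centralSum (λ l → 1ℚ · ((fromℕ (l * l) - c) · sign l) + c · sign l) M
      ≡⟨ centralSum-linear M 1ℚ c (λ l → (fromℕ (l * l) - c) · sign l) sign ⟩
  1ℚ · centralSum (λ l → (fromℕ (l * l) - c) · sign l) M + c · centralSum sign M
      ≡⟨ cong₂ (λ u v → 1ℚ · u + c · v) (centralSum-shift (suc m) sign) (centralSum-sign (suc m)) ⟩
  1ℚ · - centralSum sign (suc m) + c · (½ · (invFact M · invFact M))
      ≡⟨ cong (λ u → 1ℚ · - u + c · (½ · (invFact M · invFact M))) (trans (centralSum-sign m) (cong (λ f → ½ · (f · f)) (sym (invFact-suc (suc m))))) ⟩
  1ℚ · - (½ · ((invFact M · fromℕ M) · (invFact M · fromℕ M))) + c · (½ · (invFact M · invFact M))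
      ≡⟨ cong (λ u → 1ℚ · - (½ · ((invFact M · fromℕ M) · (invFact M · fromℕ M))) + u · (½ · (invFact M · invFact M))) (fromℕ-homo-* M M) ⟩
  1ℚ · - (½ · ((invFact M · fromℕ M) · (invFact M · fromℕ M))) + fromℕ M · fromℕ M · (½ · (invFact M · invFact M))
      ≡⟨ cancel (invFact M) (fromℕ M) ⟩
  0ℚ ∎
  where
  open ≡-Reasoning
  split : ∀ s x c → s · x ≡ 1ℚ · ((x - c) · s) + c · s
  split = solve-∀ ℚ-ring
  cancel : ∀ f n → 1ℚ · - (½ · ((f · n) · (f · n))) + n · n · (½ · (f · f)) ≡ 0ℚ
  cancel = solve-∀ ℚ-ring
  M = suc (suc m)
  c = fromℕ (M * M)

inner-vanishes : ∀ N k → inner N (suc (suc (N ℕ.+ k))) ≡ 0ℚ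
inner-vanishes zero    k = inner-zero-vanishes k
inner-vanishes (suc N) k = begin
  inner (suc N) (suc m)              ≡⟨ inner-suc N m ⟩
  - inner N m + c · inner N (suc m)
      ≡⟨ cong₂ (λ u v → - u + c · v) (inner-vanishes N k) (trans (cong (λ t → inner N (suc (suc t))) (sym (ℕ.+-suc N k))) (inner-vanishes N (suc k))) ⟩
  - 0ℚ + c · 0ℚ                  ≡⟨ cong (- 0ℚ +_) (*-zeroʳ c) ⟩
  0ℚ                             ∎
  where
  open ≡-Reasoning
  m = suc (suc (N ℕ.+ k))
  c = fromℕ (suc m * suc m) - 1ℚ

inner-diagonal : ∀ j → inner j (suc j) ≡ -½ · sign j
inner-diagonal zero    = refl
inner-diagonal (suc j) = begin
  inner (suc j) (suc (suc j))                  ≡⟨ inner-suc j (suc j) ⟩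
  - inner j (suc j) + c · inner j (suc (suc j))
      ≡⟨ cong₂ (λ u v → - u + c · v) (inner-diagonal j) (trans (cong (λ t → inner j (suc (suc t))) (sym (ℕ.+-identityʳ j))) (inner-vanishes j 0)) ⟩
  - (-½ · sign j) + c · 0ℚ                 ≡⟨ simplify (sign j) c ⟩
  -½ · - sign j                            ≡⟨ cong (-½ ·_) (sign-suc j) ⟨
  -½ · sign (suc j)                        ∎
  where
  open ≡-Reasoning
  simplify : ∀ s c → - (-½ · s) + c · 0ℚ ≡ -½ · - s
  simplify = solve-∀ ℚ-ring
  c = fromℕ (suc (suc j) * suc (suc j)) - 1ℚ

-- Coefficients in the falling-factorial basis 1, x, x(x-1), x(x-1)(x-2), …
newton : List ℚ → ℚ → ℚ
newton []       x = 0ℚ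
newton (c ∷ cs) x = c + x · newton cs (x - 1ℚ)

infixl 6 _⊕_
_⊕_ : List ℚ → List ℚ → List ℚ
[]       ⊕ bs       = bs
(a ∷ as) ⊕ []       = a ∷ as
(a ∷ as) ⊕ (b ∷ bs) = a + b ∷ as ⊕ bs

scale : ℚ → List ℚ → List ℚ
scale k = map (k ·_)

-- x · x(x-1)…(x-i+1) = x(x-1)…(x-i) + i · x(x-1)…(x-i+1)
mulX : List ℚ → List ℚ
mulX []       = []
mulX (c ∷ cs) = 0ℚ ∷ (c ∷ []) ⊕ (cs ⊕ mulX cs)

-- (x+k+i) x(x-1)…(x-i+1) - x · (x-1)(x-2)…(x-i) = (k+i) x(x-1)…(x-i+1): the difference operator is diagonal.
divDiagonal : ℕ → List ℚ → List ℚ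
divDiagonal k []       = []
divDiagonal k (a ∷ as) = a · 1/ℕ (suc k) ∷ divDiagonal (suc k) as

newton-⊕ : ∀ as bs x → newton (as ⊕ bs) x ≡ newton as x + newton bs x
newton-⊕ []       bs       x = sym (+-identityˡ (newton bs x))
newton-⊕ (a ∷ as) []       x = sym (+-identityʳ (newton (a ∷ as) x))
newton-⊕ (a ∷ as) (b ∷ bs) x = trans (cong (λ t → a + b + x · t) (newton-⊕ as bs (x - 1ℚ)))
  (regroup a b x (newton as (x - 1ℚ)) (newton bs (x - 1ℚ)))
  where
  regroup : ∀ a b x u v → a + b + x · (u + v) ≡ a + x · u + (b + x · v)
  regroup = solve-∀ ℚ-ring

newton-scale : ∀ k as x → newton (scale k as) x ≡ k · newton as x
newton-scale k []       x = sym (*-zeroʳ k)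
newton-scale k (a ∷ as) x = trans (cong (λ t → k · a + x · t) (newton-scale k as (x - 1ℚ)))
  (regroup k a x (newton as (x - 1ℚ)))
  where
  regroup : ∀ k a x u → k · a + x · (k · u) ≡ k · (a + x · u)
  regroup = solve-∀ ℚ-ring

newton-mulX : ∀ as x → newton (mulX as) x ≡ x · newton as x
newton-mulX []       x = sym (*-zeroʳ x)
newton-mulX (c ∷ cs) x = begin
  0ℚ + x · newton ((c ∷ []) ⊕ (cs ⊕ mulX cs)) (x - 1ℚ)
      ≡⟨ cong (λ t → 0ℚ + x · t) (trans (newton-⊕ (c ∷ []) (cs ⊕ mulX cs) (x - 1ℚ)) (cong (newton (c ∷ []) (x - 1ℚ) +_) (newton-⊕ cs (mulX cs) (x - 1ℚ)))) ⟩
  0ℚ + x · ((c + (x - 1ℚ) · 0ℚ) + (e + newton (mulX cs) (x - 1ℚ)))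
      ≡⟨ cong (λ t → 0ℚ + x · ((c + (x - 1ℚ) · 0ℚ) + (e + t))) (newton-mulX cs (x - 1ℚ)) ⟩
  0ℚ + x · ((c + (x - 1ℚ) · 0ℚ) + (e + (x - 1ℚ) · e))
      ≡⟨ regroup c x e ⟩
  x · (c + x · e) ∎
  where
  open ≡-Reasoning
  regroup : ∀ c x e → 0ℚ + x · ((c + (x - 1ℚ) · 0ℚ) + (e + (x - 1ℚ) · e)) ≡ x · (c + x · e)
  regroup = solve-∀ ℚ-ring
  e = newton cs (x - 1ℚ)

newton-divDiagonal : ∀ as k x →
  (x + fromℕ (suc k)) · newton (divDiagonal k as) x - x · newton (divDiagonal k as) (x - 1ℚ) ≡ newton as x
newton-divDiagonal []       k x = cancel x (fromℕ (suc k))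
  where
  cancel : ∀ x i → (x + i) · 0ℚ - x · 0ℚ ≡ 0ℚ
  cancel = solve-∀ ℚ-ring
newton-divDiagonal (a ∷ as) k x = begin
  (x + n) · (d + x · e₁) - x · (d + (x - 1ℚ) · e₂)                 ≡⟨ regroup x n d e₁ e₂ ⟩
  n · d + x · ((x - 1ℚ + (n + 1ℚ)) · e₁ - (x - 1ℚ) · e₂)
      ≡⟨ cong (λ t → n · d + x · ((x - 1ℚ + t) · e₁ - (x - 1ℚ) · e₂)) (sym (fromℕ-suc (suc k))) ⟩
  n · d + x · ((x - 1ℚ + fromℕ (suc (suc k))) · e₁ - (x - 1ℚ) · e₂) ≡⟨ cong (λ t → n · d + x · t) (newton-divDiagonal as (suc k) (x - 1ℚ)) ⟩
  n · d + x · newton as (x - 1ℚ)                                    ≡⟨ cong (_+ x · newton as (x - 1ℚ)) n*d≡a ⟩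
  a + x · newton as (x - 1ℚ)                                        ∎
  where
  open ≡-Reasoning
  regroup : ∀ x n d e₁ e₂ → (x + n) · (d + x · e₁) - x · (d + (x - 1ℚ) · e₂) ≡ n · d + x · ((x - 1ℚ + (n + 1ℚ)) · e₁ - (x - 1ℚ) · e₂)
  regroup = solve-∀ ℚ-ring
  swap : ∀ n a r → n · (a · r) ≡ a · (r · n)
  swap = solve-∀ ℚ-ring
  n = fromℕ (suc k)
  d = a · 1/ℕ (suc k)
  e₁ = newton (divDiagonal (suc k) as) (x - 1ℚ)
  e₂ = newton (divDiagonal (suc k) as) (x - 1ℚ - 1ℚ)
  n*d≡a : n · d ≡ a
  n*d≡a = trans (swap n a (1/ℕ (suc k))) (trans (cong (a ·_) (1/ℕ-inverseˡ (suc k))) (*-identityʳ a))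

newton-degree : ∀ as d → length as ≤ suc d → Degree≤ d (newton as)
newton-degree []           d       _         = Degree≤-const d 0ℚ
newton-degree (c ∷ [])     zero    _         = λ x → trans (c+x·0≡c c x) (sym (c+x·0≡c c 0ℚ))
  where
  c+x·0≡c : ∀ c x → c + x · 0ℚ ≡ c
  c+x·0≡c = solve-∀ ℚ-ring
newton-degree (c ∷ c′ ∷ cs) zero   (s≤s ())
newton-degree (c ∷ cs)     (suc d) (s≤s len≤) =
  Degree≤-+ (suc d) (Degree≤-const (suc d) c) (Degree≤-x* d (Degree≤-translate d (- 1ℚ) (newton-degree cs d len≤)))

length-⊕ : ∀ as bs {k} → length as ≤ k → length bs ≤ k → length (as ⊕ bs) ≤ k
length-⊕ []       bs       _           bs≤ = bs≤
length-⊕ (a ∷ as) []       as≤         _   = as≤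
length-⊕ (a ∷ as) (b ∷ bs) (s≤s as≤) (s≤s bs≤) = s≤s (length-⊕ as bs as≤ bs≤)

length-mulX : ∀ as → length (mulX as) ≤ suc (length as)
length-mulX []       = z≤n
length-mulX (c ∷ cs) = s≤s (length-⊕ (c ∷ []) (cs ⊕ mulX cs) (s≤s z≤n)
                                     (length-⊕ cs (mulX cs) (ℕ.n≤1+n _) (length-mulX cs)))

length-divDiagonal : ∀ k as → length (divDiagonal k as) ≡ length as
length-divDiagonal k []       = refl
length-divDiagonal k (a ∷ as) = cong suc (length-divDiagonal (suc k) as)

x[x+2]· : List ℚ → List ℚ
x[x+2]· as = mulX (mulX as) ⊕ scale (fromℕ 2) (mulX as)

newton-x[x+2]· : ∀ as x → newton (x[x+2]· as) x ≡ x · (x + fromℕ 2) · newton as x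
newton-x[x+2]· as x = begin
  newton (mulX (mulX as) ⊕ scale (fromℕ 2) (mulX as)) x              ≡⟨ newton-⊕ (mulX (mulX as)) (scale (fromℕ 2) (mulX as)) x ⟩
  newton (mulX (mulX as)) x + newton (scale (fromℕ 2) (mulX as)) x
      ≡⟨ cong₂ _+_ (trans (newton-mulX (mulX as) x) (cong (x ·_) (newton-mulX as x)))
                                                                                  (trans (newton-scale (fromℕ 2) (mulX as) x) (cong (fromℕ 2 ·_) (newton-mulX as x))) ⟩
  x · (x · newton as x) + fromℕ 2 · (x · newton as x)                ≡⟨ factor x (fromℕ 2) (newton as x) ⟩
  x · (x + fromℕ 2) · newton as x                                    ∎
  where
  open ≡-Reasoning
  factor : ∀ x t e → x · (x · e) + t · (x · e) ≡ x · (x + t) · e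
  factor = solve-∀ ℚ-ring

length-x[x+2]· : ∀ as {k} → length as ≤ k → length (x[x+2]· as) ≤ suc (suc k)
length-x[x+2]· as {k} as≤k = length-⊕ (mulX (mulX as)) (scale (fromℕ 2) (mulX as))
  (ℕ.≤-trans (length-mulX (mulX as)) (s≤s (ℕ.≤-trans (length-mulX as) (s≤s as≤k))))
  (subst (_≤ suc (suc k)) (sym (length-map (fromℕ 2 ·_) (mulX as)))
         (ℕ.≤-trans (length-mulX as) (s≤s (ℕ.≤-trans as≤k (ℕ.n≤1+n k)))))

F-coefficients : ℕ → List ℚ
F-coefficients zero    = 1ℚ ∷ []
F-coefficients (suc n) = divDiagonal n (x[x+2]· (F-coefficients n))

F : ℕ → ℚ → ℚ
F n = newton (F-coefficients n)

F-zero : ∀ x → F 0 x ≡ 1ℚ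
F-zero x = trans (cong (1ℚ +_) (*-zeroʳ x)) (+-identityʳ 1ℚ)

F-suc : ∀ n x → (x + fromℕ (suc n)) · F (suc n) x - x · F (suc n) (x - 1ℚ) ≡ x · (x + fromℕ 2) · F n x
F-suc n x = trans (newton-divDiagonal (x[x+2]· (F-coefficients n)) n x) (newton-x[x+2]· (F-coefficients n) x)

F-degree : ∀ n → Degree≤ (2 * n) (F n)
F-degree n = newton-degree (F-coefficients n) (2 * n) (length≤ n)
  where
  2[1+n]≡ : ∀ n → suc (suc (suc (2 * n))) ≡ suc (2 * suc n)
  2[1+n]≡ = ℕ-Solver.solve-∀
  length≤ : ∀ n → length (F-coefficients n) ≤ suc (2 * n)
  length≤ zero    = s≤s z≤n
  length≤ (suc n) = subst₂ _≤_ (sym (length-divDiagonal n (x[x+2]· (F-coefficients n)))) (2[1+n]≡ n)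
                           (length-x[x+2]· (F-coefficients n) (length≤ n))

F[1+n]-at-0 : ∀ n → F (suc n) 0ℚ ≡ 0ℚ
F[1+n]-at-0 n = *-cancelˡ-≢0 (fromℕ[1+n]≢0 n) (begin
  fromℕ (suc n) · F (suc n) 0ℚ                                             ≡⟨ lhs (fromℕ (suc n)) (F (suc n) 0ℚ) (F (suc n) (0ℚ - 1ℚ)) ⟩
  (0ℚ + fromℕ (suc n)) · F (suc n) 0ℚ - 0ℚ · F (suc n) (0ℚ - 1ℚ)           ≡⟨ F-suc n 0ℚ ⟩
  0ℚ · (0ℚ + fromℕ 2) · F n 0ℚ                                             ≡⟨ rhs (fromℕ (suc n)) (F n 0ℚ) ⟩
  fromℕ (suc n) · 0ℚ                                                       ∎)
  where
  open ≡-Reasoning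
  lhs : ∀ m a b → m · a ≡ (0ℚ + m) · a - 0ℚ · b
  lhs = solve-∀ ℚ-ring
  rhs : ∀ m c → 0ℚ · (0ℚ + fromℕ 2) · c ≡ m · 0ℚ
  rhs = solve-∀ ℚ-ring

private
  inner-suc-suc : ∀ n j → inner (suc j ℕ.+ suc n) (suc (suc j)) ≡
    - inner (j ℕ.+ suc n) (suc j) + (fromℕ (suc (suc j) * suc (suc j)) - 1ℚ) · inner (suc j ℕ.+ n) (suc (suc j))
  inner-suc-suc n j = trans (inner-suc (j ℕ.+ suc n) (suc j))
    (cong (λ t → - inner (j ℕ.+ suc n) (suc j) + (fromℕ (suc (suc j) * suc (suc j)) - 1ℚ) · inner t (suc (suc j))) (ℕ.+-suc j n))

  [j+2]²-1 : ∀ j → fromℕ (suc (suc j) * suc (suc j)) - 1ℚ ≡ fromℕ (suc j) · (fromℕ (suc j) + fromℕ 2)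
  [j+2]²-1 j = begin
    fromℕ (suc (suc j) * suc (suc j)) - 1ℚ                  ≡⟨ cong (λ k → fromℕ k - 1ℚ) (ℕ-identity j) ⟩
    fromℕ (suc j * (suc j ℕ.+ 2) ℕ.+ 1) - 1ℚ                ≡⟨ cong (_- 1ℚ) (fromℕ-homo-+ (suc j * (suc j ℕ.+ 2)) 1) ⟩
    fromℕ (suc j * (suc j ℕ.+ 2)) + 1ℚ - 1ℚ                 ≡⟨ cancel (fromℕ (suc j * (suc j ℕ.+ 2))) ⟩
    fromℕ (suc j * (suc j ℕ.+ 2))
        ≡⟨ trans (fromℕ-homo-* (suc j) (suc j ℕ.+ 2)) (cong (fromℕ (suc j) ·_) (fromℕ-homo-+ (suc j) 2)) ⟩
    fromℕ (suc j) · (fromℕ (suc j) + fromℕ 2)                 ∎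
    where
    open ≡-Reasoning
    cancel : ∀ x → x + 1ℚ - 1ℚ ≡ x
    cancel = solve-∀ ℚ-ring
    ℕ-identity : ∀ j → suc (suc j) * suc (suc j) ≡ suc j * (suc j ℕ.+ 2) ℕ.+ 1
    ℕ-identity = ℕ-Solver.solve-∀

inner≡F : ∀ n j → inner (j ℕ.+ n) (suc j) ≡ -½ · sign j · F n (fromℕ j) · fromℕ ((j ℕ.+ n) !) · invFact j
inner≡F zero j = begin
  inner (j ℕ.+ 0) (suc j)        ≡⟨ cong (λ t → inner t (suc j)) (ℕ.+-identityʳ j) ⟩
  inner j (suc j)                ≡⟨ inner-diagonal j ⟩
  -½ · sign j                    ≡⟨ pad (-½ · sign j) ⟩
  -½ · sign j · 1ℚ · 1ℚ          ≡⟨ cong₂ (λ u v → -½ · sign j · u · v) (sym (F-zero (fromℕ j)))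
                                          (sym (trans (cong (λ k → fromℕ (k !) · invFact j) (ℕ.+-identityʳ j)) (1/ℕ-inverseʳ (j !) {{j !≢0}}))) ⟩
  -½ · sign j · F 0 (fromℕ j) · (fromℕ ((j ℕ.+ 0) !) · invFact j)
                                 ≡⟨ *-assoc (-½ · sign j · F 0 (fromℕ j)) (fromℕ ((j ℕ.+ 0) !)) (invFact j) ⟨
  -½ · sign j · F 0 (fromℕ j) · fromℕ ((j ℕ.+ 0) !) · invFact j ∎
  where
  open ≡-Reasoning
  pad : ∀ x → x ≡ x · 1ℚ · 1ℚ
  pad = solve-∀ ℚ-ring
inner≡F (suc n) zero = begin
  inner (suc n) 1                               ≡⟨ inner-suc n 0 ⟩
  - 0ℚ + (1ℚ - 1ℚ) · inner n 1                  ≡⟨ vanish (inner n 1) ⟩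
  0ℚ                                            ≡⟨ vanish′ (-½ · sign 0) (fromℕ ((0 ℕ.+ suc n) !)) (invFact 0) ⟨
  -½ · sign 0 · 0ℚ · fromℕ ((0 ℕ.+ suc n) !) · invFact 0
                                                ≡⟨ cong (λ t → -½ · sign 0 · t · fromℕ ((0 ℕ.+ suc n) !) · invFact 0) (F[1+n]-at-0 n) ⟨
  -½ · sign 0 · F (suc n) 0ℚ · fromℕ ((0 ℕ.+ suc n) !) · invFact 0 ∎
  where
  open ≡-Reasoning
  vanish : ∀ x → - 0ℚ + (1ℚ - 1ℚ) · x ≡ 0ℚ
  vanish = solve-∀ ℚ-ring
  vanish′ : ∀ a b c → a · 0ℚ · b · c ≡ 0ℚ
  vanish′ = solve-∀ ℚ-ring
inner≡F (suc n) (suc j) = begin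
  inner (suc j ℕ.+ suc n) (suc (suc j))                                ≡⟨ inner-suc-suc n j ⟩
  - inner (j ℕ.+ suc n) (suc j) + (fromℕ (suc (suc j) * suc (suc j)) - 1ℚ) · inner (suc j ℕ.+ n) (suc (suc j))
      ≡⟨ cong₃ (λ u c v → - u + c · v) IH₁ ([j+2]²-1 j) IH₂ ⟩
  - (-½ · s · A · g · (f · a)) + a · (a + fromℕ 2) · (-½ · - s · C · g · f)
      ≡⟨ regroup s A g f a C ⟩
  ½ · s · g · f · (a · A + a · (a + fromℕ 2) · C)                        ≡⟨ cong (½ · s · g · f ·_) F-step ⟩
  ½ · s · g · f · ((a + b) · B)                                         ≡⟨ regroup′ s g f a b B ⟩
  -½ · - s · B · ((a + b) · g) · f
      ≡⟨ cong₂ (λ u v → -½ · u · B · v · f) (sym (sign-suc j)) (sym factorial-step) ⟩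
  -½ · sign (suc j) · B · fromℕ ((suc j ℕ.+ suc n) !) · f                ∎
  where
  open ≡-Reasoning
  regroup : ∀ s A g f a C → - (-½ · s · A · g · (f · a)) + a · (a + fromℕ 2) · (-½ · - s · C · g · f)
                            ≡ ½ · s · g · f · (a · A + a · (a + fromℕ 2) · C)
  regroup = solve-∀ ℚ-ring
  regroup′ : ∀ s g f a b B → ½ · s · g · f · ((a + b) · B) ≡ -½ · - s · B · ((a + b) · g) · f
  regroup′ = solve-∀ ℚ-ring
  add-back : ∀ x y → x + (y - x) ≡ y
  add-back = solve-∀ ℚ-ring
  s = sign j
  a = fromℕ (suc j)
  b = fromℕ (suc n)
  A = F (suc n) (fromℕ j)
  B = F (suc n) a
  C = F n a
  g = fromℕ ((suc (j ℕ.+ n)) !)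
  f = invFact (suc j)
  IH₁ : inner (j ℕ.+ suc n) (suc j) ≡ -½ · s · A · g · (f · a)
  IH₁ = trans (inner≡F (suc n) j) (cong₂ (λ k v → -½ · s · A · fromℕ (k !) · v) (ℕ.+-suc j n) (sym (invFact-suc j)))
  IH₂ : inner (suc j ℕ.+ n) (suc (suc j)) ≡ -½ · - s · C · g · f
  IH₂ = trans (inner≡F n (suc j)) (cong (λ u → -½ · u · C · g · f) (sign-suc j))
  F-step : a · A + a · (a + fromℕ 2) · C ≡ (a + b) · B
  F-step = begin
    a · A + a · (a + fromℕ 2) · C                  ≡⟨ cong (a · A +_) (F-suc n a) ⟨
    a · A + ((a + b) · B - a · F (suc n) (a - 1ℚ))
        ≡⟨ cong (λ x → a · A + ((a + b) · B - a · F (suc n) x)) (trans (cong (_- 1ℚ) (fromℕ-suc j)) (x+1-1≡x (fromℕ j))) ⟩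
    a · A + ((a + b) · B - a · A)                  ≡⟨ add-back (a · A) ((a + b) · B) ⟩
    (a + b) · B                                    ∎
    where
    x+1-1≡x : ∀ x → x + 1ℚ - 1ℚ ≡ x
    x+1-1≡x = solve-∀ ℚ-ring
  factorial-step : fromℕ ((suc j ℕ.+ suc n) !) ≡ (a + b) · g
  factorial-step = begin
    fromℕ ((suc j ℕ.+ suc n) !)                       ≡⟨ cong (λ k → fromℕ (suc k !)) (ℕ.+-suc j n) ⟩
    fromℕ (suc (suc (j ℕ.+ n)) * suc (j ℕ.+ n) !)   ≡⟨ fromℕ-homo-* (suc (suc (j ℕ.+ n))) (suc (j ℕ.+ n) !) ⟩
    fromℕ (suc (suc (j ℕ.+ n))) · g                   ≡⟨ cong (λ k → fromℕ k · g) (sym (ℕ.+-suc (suc j) n)) ⟩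
    fromℕ (suc j ℕ.+ suc n) · g                       ≡⟨ cong (_· g) (fromℕ-homo-+ (suc j) (suc n)) ⟩
    (a + b) · g                                       ∎

infixl 7 _⋆_
_⋆_ : (ℕ → ℚ) → (ℕ → ℚ) → ℕ → ℚ
(u ⋆ v) n = ∑[ k ≤ n ] (u k · v (n ∸ k))

⋆-cong : ∀ {u u′ v v′} n → (∀ k → u k ≡ u′ k) → (∀ k → v k ≡ v′ k) → (u ⋆ v) n ≡ (u′ ⋆ v′) n
⋆-cong n u≗u′ v≗v′ = ∑-cong n (λ k → cong₂ _·_ (u≗u′ k) (v≗v′ (n ∸ k)))

⋆-linearˡ : ∀ u u′ v c n → ((λ k → u k + c · u′ k) ⋆ v) n ≡ (u ⋆ v) n + c · (u′ ⋆ v) n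
⋆-linearˡ u u′ v c n = trans (∑-cong n (λ k → distrib (u k) (u′ k) c (v (n ∸ k))))
  (trans (∑-+ n (λ k → u k · v (n ∸ k)) (λ k → c · (u′ k · v (n ∸ k)))) (cong ((u ⋆ v) n +_) (∑-*ˡ n c (λ k → u′ k · v (n ∸ k)))))
  where
  distrib : ∀ a b c d → (a + c · b) · d ≡ a · d + c · (b · d)
  distrib = solve-∀ ℚ-ring

⋆-linearʳ : ∀ u v v′ c n → (u ⋆ (λ k → v k + c · v′ k)) n ≡ (u ⋆ v) n + c · (u ⋆ v′) n
⋆-linearʳ u v v′ c n = trans (∑-cong n (λ k → distrib (v (n ∸ k)) (v′ (n ∸ k)) c (u k)))
  (trans (∑-+ n (λ k → u k · v (n ∸ k)) (λ k → c · (u k · v′ (n ∸ k)))) (cong ((u ⋆ v) n +_) (∑-*ˡ n c (λ k → u k · v′ (n ∸ k)))))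
  where
  distrib : ∀ a b c d → d · (a + c · b) ≡ d · a + c · (d · b)
  distrib = solve-∀ ℚ-ring

⋆-*ˡ : ∀ c u v n → ((λ k → c · u k) ⋆ v) n ≡ c · (u ⋆ v) n
⋆-*ˡ c u v n = trans (∑-cong n (λ k → *-assoc c (u k) (v (n ∸ k)))) (∑-*ˡ n c (λ k → u k · v (n ∸ k)))

⋆-*ʳ : ∀ c u v n → (u ⋆ (λ k → c · v k)) n ≡ c · (u ⋆ v) n
⋆-*ʳ c u v n = trans (∑-cong n (λ k → swap c (u k) (v (n ∸ k)))) (∑-*ˡ n c (λ k → u k · v (n ∸ k)))
  where
  swap : ∀ c x y → x · (c · y) ≡ c · (x · y)
  swap = solve-∀ ℚ-ring

-- Multiplication of the generating function by t.
shift : (ℕ → ℚ) → ℕ → ℚ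
shift u zero    = 0ℚ
shift u (suc k) = u k

⋆-shift : ∀ u w n → (u ⋆ shift w) n ≡ (shift u ⋆ w) n
⋆-shift u w zero    = trans (*-zeroʳ (u 0)) (sym (*-zeroˡ (w 0)))
⋆-shift u w (suc m) = begin
  ∑[ k ≤ suc m ] (u k · shift w (suc m ∸ k))                         ≡⟨ ∑-last m (λ k → u k · shift w (suc m ∸ k)) ⟩
  ∑[ k ≤ m ] (u k · shift w (suc m ∸ k)) + u (suc m) · shift w (m ∸ m)
      ≡⟨ cong₂ _+_ (∑-cong≤ m (λ k k≤m → cong (λ t → u k · shift w t) (ℕ.+-∸-assoc 1 k≤m)))
                   (trans (cong (λ t → u (suc m) · shift w t) (ℕ.n∸n≡0 m)) (*-zeroʳ (u (suc m)))) ⟩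
  (u ⋆ w) m + 0ℚ                                                     ≡⟨ +-identityʳ ((u ⋆ w) m) ⟩
  (u ⋆ w) m                                                          ≡⟨ +-identityˡ ((u ⋆ w) m) ⟨
  0ℚ + (u ⋆ w) m                                                     ≡⟨ cong (_+ (u ⋆ w) m) (*-zeroˡ (w (suc m))) ⟨
  (shift u ⋆ w) (suc m)                                              ∎
  where open ≡-Reasoning

-- In generating functions: U = U′ / (1 - a t) and V = V′ (1 - a t), so U V = U′ V′.
⋆-cancel-geometric : ∀ u u′ v v′ a → (∀ k → u k ≡ u′ k + a · shift u k) → (∀ k → v k ≡ v′ k + - a · shift v′ k) →
  ∀ n → (u ⋆ v) n ≡ (u′ ⋆ v′) n
⋆-cancel-geometric u u′ v v′ a u≡ v≡ n = begin
  (u ⋆ v) n                                    ≡⟨ ⋆-cong {u} {u} {v} n (λ _ → refl) v≡ ⟩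
  (u ⋆ (λ k → v′ k + - a · shift v′ k)) n      ≡⟨ ⋆-linearʳ u v′ (shift v′) (- a) n ⟩
  (u ⋆ v′) n + - a · (u ⋆ shift v′) n          ≡⟨ cong (λ t → (u ⋆ v′) n + - a · t) (⋆-shift u v′ n) ⟩
  (u ⋆ v′) n + - a · (shift u ⋆ v′) n          ≡⟨ ⋆-linearˡ u (shift u) v′ (- a) n ⟨
  ((λ k → u k + - a · shift u k) ⋆ v′) n
      ≡⟨ ⋆-cong {v = v′} n (λ k → trans (cong (_+ - a · shift u k) (u≡ k)) (cancel (u′ k) a (shift u k))) (λ _ → refl) ⟩
  (u′ ⋆ v′) n                                  ∎
  where
  open ≡-Reasoning
  cancel : ∀ p a s → p + a · s + - a · s ≡ p
  cancel = solve-∀ ℚ-ring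

-- The coefficient of tⁿ⁺¹ in U² is 2 u₀ uₙ₊₁ plus terms involving only u₁, …, uₙ.
⋆-self-injective : ∀ u v → u 0 ≡ 1ℚ → v 0 ≡ 1ℚ → (∀ n → (u ⋆ u) n ≡ (v ⋆ v) n) → ∀ n → u n ≡ v n
⋆-self-injective u v u₀≡1 v₀≡1 u²≡v² n = agree n n ℕ.≤-refl
  where
  middle : (ℕ → ℚ) → ℕ → ℚ
  middle z zero    = 0ℚ
  middle z (suc n) = ∑[ i ≤ n ] (z (suc i) · z (suc n ∸ i))
  split : ∀ x r → (1ℚ + 1ℚ) · x ≡ x · 1ℚ + x · 1ℚ + r - r
  split = solve-∀ ℚ-ring
  regroup : ∀ p q r → p · q + p · q + r ≡ q · p + (r + p · q)
  regroup = solve-∀ ℚ-ring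
  last-split : ∀ z n → ∑[ i ≤ n ] (z (suc i) · z (n ∸ i)) ≡ middle z n + z (suc n) · z 0
  last-split z zero    = sym (+-identityˡ (z 1 · z 0))
  last-split z (suc m) = trans (∑-last m (λ i → z (suc i) · z (suc m ∸ i)))
                               (cong (λ k → middle z (suc m) + z (suc (suc m)) · z k) (ℕ.n∸n≡0 m))
  outer+middle : ∀ z n → z (suc n) · z 0 + z (suc n) · z 0 + middle z n ≡ (z ⋆ z) (suc n)
  outer+middle z n = trans (regroup (z (suc n)) (z 0) (middle z n)) (cong (z 0 · z (suc n) +_) (sym (last-split z n)))
  middle-agree : ∀ n → (∀ k → k ≤ n → u k ≡ v k) → middle u n ≡ middle v n
  middle-agree zero    _     = refl
  middle-agree (suc m) u≡v = ∑-cong≤ m (λ i i≤m →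
    cong₂ _·_ (u≡v (suc i) (s≤s i≤m)) (u≡v (suc m ∸ i) (ℕ.m∸n≤m (suc m) i)))
  agree : ∀ n k → k ≤ n → u k ≡ v k
  agree zero    zero    _   = trans u₀≡1 (sym v₀≡1)
  agree (suc n) k       k≤n with ℕ.m≤n⇒m<n∨m≡n k≤n
  ... | inj₁ (s≤s k≤n′) = agree n k k≤n′
  ... | inj₂ refl       = *-cancelˡ-≢0 (fromℕ[1+n]≢0 1) (begin
    (1ℚ + 1ℚ) · u (suc n)                                       ≡⟨ split (u (suc n)) (middle u n) ⟩
    u (suc n) · 1ℚ + u (suc n) · 1ℚ + middle u n - middle u n
        ≡⟨ cong (λ w → u (suc n) · w + u (suc n) · w + middle u n - middle u n) (sym u₀≡1) ⟩
    u (suc n) · u 0 + u (suc n) · u 0 + middle u n - middle u n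
        ≡⟨ cong₂ _-_ (trans (outer+middle u n) (u²≡v² (suc n))) (middle-agree n (agree n)) ⟩
    (v ⋆ v) (suc n) - middle v n                                ≡⟨ cong (_- middle v n) (outer+middle v n) ⟨
    v (suc n) · v 0 + v (suc n) · v 0 + middle v n - middle v n
        ≡⟨ cong (λ w → v (suc n) · w + v (suc n) · w + middle v n - middle v n) v₀≡1 ⟩
    v (suc n) · 1ℚ + v (suc n) · 1ℚ + middle v n - middle v n   ≡⟨ split (v (suc n)) (middle v n) ⟨
    (1ℚ + 1ℚ) · v (suc n)                                       ∎)
    where open ≡-Reasoning

derivative : (ℕ → ℚ) → ℕ → ℚ
derivative u k = fromℕ (suc k) · u (suc k)

⋆-leibniz : ∀ u w m → fromℕ (suc m) · (u ⋆ w) (suc m) ≡ (derivative u ⋆ w) m + (u ⋆ derivative w) m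
⋆-leibniz u w m = begin
  fromℕ (suc m) · ∑ (suc m) t                                   ≡⟨ ∑-*ˡ (suc m) (fromℕ (suc m)) t ⟨
  ∑[ k ≤ suc m ] (fromℕ (suc m) · t k)                          ≡⟨ ∑-cong≤ (suc m) split ⟩
  ∑[ k ≤ suc m ] (fromℕ k · t k + fromℕ (suc m ∸ k) · t k)      ≡⟨ ∑-+ (suc m) (λ k → fromℕ k · t k) (λ k → fromℕ (suc m ∸ k) · t k) ⟩
  ∑[ k ≤ suc m ] (fromℕ k · t k) + ∑[ k ≤ suc m ] (fromℕ (suc m ∸ k) · t k) ≡⟨ cong₂ _+_ lower upper ⟩
  (derivative u ⋆ w) m + (u ⋆ derivative w) m                   ∎
  where
  open ≡-Reasoning
  assocˡ : ∀ n a b → n · (a · b) ≡ n · a · b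
  assocˡ = solve-∀ ℚ-ring
  swap : ∀ n a b → n · (a · b) ≡ a · (n · b)
  swap = solve-∀ ℚ-ring
  t : ℕ → ℚ
  t k = u k · w (suc m ∸ k)
  split : ∀ k → k ≤ suc m → fromℕ (suc m) · t k ≡ fromℕ k · t k + fromℕ (suc m ∸ k) · t k
  split k k≤1+m = trans (cong (_· t k) (fromℕ-∸ k≤1+m)) (*-distribʳ-+ (t k) (fromℕ k) (fromℕ (suc m ∸ k)))
  lower : ∑[ k ≤ suc m ] (fromℕ k · t k) ≡ (derivative u ⋆ w) m
  lower = begin
    0ℚ · t 0 + ∑[ i ≤ m ] (fromℕ (suc i) · t (suc i))   ≡⟨ cong (_+ ∑[ i ≤ m ] (fromℕ (suc i) · t (suc i))) (*-zeroˡ (t 0)) ⟩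
    0ℚ + ∑[ i ≤ m ] (fromℕ (suc i) · t (suc i))         ≡⟨ +-identityˡ (∑[ i ≤ m ] (fromℕ (suc i) · t (suc i))) ⟩
    ∑[ i ≤ m ] (fromℕ (suc i) · t (suc i))              ≡⟨ ∑-cong m (λ i → assocˡ (fromℕ (suc i)) (u (suc i)) (w (m ∸ i))) ⟩
    (derivative u ⋆ w) m                                ∎
  upper : ∑[ k ≤ suc m ] (fromℕ (suc m ∸ k) · t k) ≡ (u ⋆ derivative w) m
  upper = begin
    ∑[ k ≤ suc m ] (fromℕ (suc m ∸ k) · t k)            ≡⟨ ∑-last m (λ k → fromℕ (suc m ∸ k) · t k) ⟩
    s + fromℕ (m ∸ m) · t (suc m)                       ≡⟨ cong (λ k → s + fromℕ k · t (suc m)) (ℕ.n∸n≡0 m) ⟩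
    s + 0ℚ · t (suc m)                                  ≡⟨ cong (s +_) (*-zeroˡ (t (suc m))) ⟩
    s + 0ℚ                                              ≡⟨ +-identityʳ s ⟩
    s
        ≡⟨ ∑-cong≤ m (λ k k≤m → trans (cong (λ j → fromℕ j · (u k · w j)) (ℕ.+-∸-assoc 1 k≤m))
                                                                                      (swap (fromℕ (suc (m ∸ k))) (u k) (w (suc (m ∸ k))))) ⟩
    (u ⋆ derivative w) m                                ∎
    where
    s = ∑[ k ≤ m ] (fromℕ (suc m ∸ k) · t k)

binomial : ℚ → ℕ → ℚ
binomial a zero    = 1ℚ
binomial a (suc k) = binomial a k · (a - fromℕ k) · 1/ℕ (suc k)

binomial-shift : ∀ a k → binomial a k · (a - fromℕ k) ≡ a · binomial (a - 1ℚ) k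
binomial-shift a zero    = trans (*-identityˡ (a - 0ℚ)) (trans (+-identityʳ a) (sym (*-identityʳ a)))
binomial-shift a (suc k) = begin
  binomial a k · (a - fromℕ k) · 1/ℕ (suc k) · (a - fromℕ (suc k))
      ≡⟨ cong₂ (λ b m → b · 1/ℕ (suc k) · (a - m)) (binomial-shift a k) (fromℕ-suc k) ⟩
  a · binomial (a - 1ℚ) k · 1/ℕ (suc k) · (a - (fromℕ k + 1ℚ))           ≡⟨ regroup a (binomial (a - 1ℚ) k) (1/ℕ (suc k)) (fromℕ k) ⟩
  a · binomial (a - 1ℚ) (suc k)                                          ∎
  where
  open ≡-Reasoning
  regroup : ∀ a b r m → a · b · r · (a - (m + 1ℚ)) ≡ a · (b · (a - 1ℚ - m) · r)
  regroup = solve-∀ ℚ-ring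

derivative-binomial : ∀ a k → derivative (binomial a) k ≡ a · binomial (a - 1ℚ) k
derivative-binomial a k = begin
  fromℕ (suc k) · (binomial a k · (a - fromℕ k) · 1/ℕ (suc k))   ≡⟨ regroup (fromℕ (suc k)) (binomial a k · (a - fromℕ k)) (1/ℕ (suc k)) ⟩
  binomial a k · (a - fromℕ k) · (1/ℕ (suc k) · fromℕ (suc k))   ≡⟨ cong (binomial a k · (a - fromℕ k) ·_) (1/ℕ-inverseˡ (suc k)) ⟩
  binomial a k · (a - fromℕ k) · 1ℚ                               ≡⟨ *-identityʳ (binomial a k · (a - fromℕ k)) ⟩
  binomial a k · (a - fromℕ k)                                    ≡⟨ binomial-shift a k ⟩
  a · binomial (a - 1ℚ) k                                         ∎
  where
  open ≡-Reasoning
  regroup : ∀ n b r → n · (b · r) ≡ b · (r · n)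
  regroup = solve-∀ ℚ-ring

vandermonde : ∀ n a b → (binomial a ⋆ binomial b) n ≡ binomial (a + b) n
vandermonde zero    a b = refl
vandermonde (suc m) a b = *-cancelˡ-≢0 (fromℕ[1+n]≢0 m) (begin
  fromℕ (suc m) · (binomial a ⋆ binomial b) (suc m)
      ≡⟨ ⋆-leibniz (binomial a) (binomial b) m ⟩
  (derivative (binomial a) ⋆ binomial b) m + (binomial a ⋆ derivative (binomial b)) m
      ≡⟨ cong₂ _+_ (trans (⋆-cong {v = binomial b} m (derivative-binomial a) (λ _ → refl)) (⋆-*ˡ a (binomial (a - 1ℚ)) (binomial b) m))
                   (trans (⋆-cong {u = binomial a} m (λ _ → refl) (derivative-binomial b)) (⋆-*ʳ b (binomial a) (binomial (b - 1ℚ)) m)) ⟩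
  a · (binomial (a - 1ℚ) ⋆ binomial b) m + b · (binomial a ⋆ binomial (b - 1ℚ)) m
      ≡⟨ cong₂ (λ x y → a · x + b · y) (vandermonde m (a - 1ℚ) b) (vandermonde m a (b - 1ℚ)) ⟩
  a · binomial (a - 1ℚ + b) m + b · binomial (a + (b - 1ℚ)) m
      ≡⟨ cong₂ (λ x y → a · binomial x m + b · binomial y m) (shuffle₁ a b) (shuffle₂ a b) ⟩
  a · binomial (a + b - 1ℚ) m + b · binomial (a + b - 1ℚ) m
      ≡⟨ *-distribʳ-+ (binomial (a + b - 1ℚ) m) a b ⟨
  (a + b) · binomial (a + b - 1ℚ) m
      ≡⟨ derivative-binomial (a + b) m ⟨
  fromℕ (suc m) · binomial (a + b) (suc m) ∎)
  where
  open ≡-Reasoning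
  shuffle₁ : ∀ a b → a - 1ℚ + b ≡ a + b - 1ℚ
  shuffle₁ = solve-∀ ℚ-ring
  shuffle₂ : ∀ a b → a + (b - 1ℚ) ≡ a + b - 1ℚ
  shuffle₂ = solve-∀ ℚ-ring

binomial-1 : ∀ n → binomial 1ℚ (suc (suc n)) ≡ 0ℚ
binomial-1 zero    = refl
binomial-1 (suc n) = trans (cong (λ b → b · (1ℚ - fromℕ (suc (suc n))) · 1/ℕ (suc (suc (suc n)))) (binomial-1 n))
                           (trans (cong (_· 1/ℕ (suc (suc (suc n)))) (*-zeroˡ (1ℚ - fromℕ (suc (suc n))))) (*-zeroˡ (1/ℕ (suc (suc (suc n))))))

binomial-½ : ∀ k → binomial ½ k ≡ sign k · rising -½ k · invFact k
binomial-½ zero    = refl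
binomial-½ (suc k) = begin
  binomial ½ k · (½ - fromℕ k) · 1/ℕ (suc k)                         ≡⟨ cong (λ b → b · (½ - fromℕ k) · 1/ℕ (suc k)) (binomial-½ k) ⟩
  sign k · rising -½ k · invFact k · (½ - fromℕ k) · 1/ℕ (suc k)     ≡⟨ regroup (sign k) (rising -½ k) (invFact k) (fromℕ k) (1/ℕ (suc k)) ⟩
  - sign k · (rising -½ k · (-½ + fromℕ k)) · (invFact k · 1/ℕ (suc k))
      ≡⟨ cong₂ (λ s f → s · (rising -½ k · (-½ + fromℕ k)) · f) (sym (sign-suc k)) (sym invFact-suc′) ⟩
  sign (suc k) · rising -½ (suc k) · invFact (suc k)                 ∎
  where
  open ≡-Reasoning
  regroup : ∀ s p f m r → s · p · f · (½ - m) · r ≡ - s · (p · (-½ + m)) · (f · r)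
  regroup = solve-∀ ℚ-ring
  invFact-suc′ : invFact (suc k) ≡ invFact k · 1/ℕ (suc k)
  invFact-suc′ = begin
    invFact (suc k)                                 ≡⟨ *-identityʳ (invFact (suc k)) ⟨
    invFact (suc k) · 1ℚ                            ≡⟨ cong (invFact (suc k) ·_) (1/ℕ-inverseʳ (suc k)) ⟨
    invFact (suc k) · (fromℕ (suc k) · 1/ℕ (suc k)) ≡⟨ *-assoc (invFact (suc k)) (fromℕ (suc k)) (1/ℕ (suc k)) ⟨
    invFact (suc k) · fromℕ (suc k) · 1/ℕ (suc k)   ≡⟨ cong (_· 1/ℕ (suc k)) (invFact-suc k) ⟩
    invFact k · 1/ℕ (suc k)                         ∎

h : ℕ → ℚ → ℚ
h k x = rising x k · F k (x - 1ℚ)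

h-zero : ∀ x → h 0 x ≡ 1ℚ
h-zero x = trans (*-identityˡ (F 0 (x - 1ℚ))) (F-zero (x - 1ℚ))

-- The difference equation of F, multiplied by the rising factorial.
h-suc : ∀ k x → h (suc k) x ≡ h (suc k) (x - 1ℚ) + (x · x - 1ℚ) · h k x
h-suc k x = begin
  rising x k · (x + fromℕ k) · F (suc k) y                  ≡⟨ cong (λ t → rising x k · t · F (suc k) y) x+k≡ ⟩
  rising x k · (y + fromℕ (suc k)) · F (suc k) y
      ≡⟨ expand (rising x k) (y + fromℕ (suc k)) (F (suc k) y) (F (suc k) (y - 1ℚ)) y ⟩
  rising x k · ((y + fromℕ (suc k)) · F (suc k) y - y · F (suc k) (y - 1ℚ)) + y · rising x k · F (suc k) (y - 1ℚ)
      ≡⟨ cong₂ (λ u v → rising x k · u + v · F (suc k) (y - 1ℚ)) (F-suc k y) (sym rising-y) ⟩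
  rising x k · (y · (y + fromℕ 2) · F k y) + rising y (suc k) · F (suc k) (y - 1ℚ)
      ≡⟨ regroup (rising x k) y (F k y) (rising y (suc k) · F (suc k) (y - 1ℚ)) ⟩
  h (suc k) y + y · (y + fromℕ 2) · h k x                   ≡⟨ cong (λ t → h (suc k) y + t · h k x) (square x) ⟩
  h (suc k) y + (x · x - 1ℚ) · h k x                        ∎
  where
  open ≡-Reasoning
  expand : ∀ p a b c y → p · a · b ≡ p · (a · b - y · c) + y · p · c
  expand = solve-∀ ℚ-ring
  regroup : ∀ p y f q → p · (y · (y + fromℕ 2) · f) + q ≡ q + y · (y + fromℕ 2) · (p · f)
  regroup = solve-∀ ℚ-ring
  square : ∀ x → (x - 1ℚ) · (x - 1ℚ + fromℕ 2) ≡ x · x - 1ℚ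
  square = solve-∀ ℚ-ring
  shift-back : ∀ x k → x + k ≡ x - 1ℚ + (k + 1ℚ)
  shift-back = solve-∀ ℚ-ring
  x-1+1≡x : ∀ x → x - 1ℚ + 1ℚ ≡ x
  x-1+1≡x = solve-∀ ℚ-ring
  y = x - 1ℚ
  x+k≡ : x + fromℕ k ≡ y + fromℕ (suc k)
  x+k≡ = trans (shift-back x (fromℕ k)) (cong (y +_) (sym (fromℕ-suc k)))
  rising-y : rising y (suc k) ≡ y · rising x k
  rising-y = trans (rising-suc′ y k) (cong (λ t → y · rising t k) (x-1+1≡x x))

h-degree : ∀ k → Degree≤ (k ℕ.+ 2 * k) (h k)
h-degree k = Degree≤-* k (2 * k) (rising-degree k) (Degree≤-translate (2 * k) (- 1ℚ) (F-degree k))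
  where
  rising-degree : ∀ k → Degree≤ k (λ x → rising x k)
  rising-degree zero    = Degree≤-const 0 1ℚ
  rising-degree (suc k) = subst (λ d → Degree≤ d (λ x → rising x (suc k))) (ℕ.+-comm k 1)
                                (Degree≤-* k 1 (rising-degree k) (Degree≤-x+c (fromℕ k)))

-- Q n x is the coefficient of tⁿ in H(x) H(-1-x), with H(x) = ∑ₖ h k x tᵏ.
Q : ℕ → ℚ → ℚ
Q n x = ((λ k → h k x) ⋆ (λ k → h k (- 1ℚ - x))) n

Q-degree : ∀ n → Degree≤ ((n ℕ.+ 2 * n) ℕ.+ (n ℕ.+ 2 * n)) (Q n)
Q-degree n = Degree≤-∑ (d′ ℕ.+ d′) n λ k k≤n →
  Degree≤-* d′ d′ (Degree≤-mono (bound k≤n) (h-degree k))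
                  (Degree≤-mono (bound (ℕ.m∸n≤m n k)) (reflected (n ∸ k)))
  where
  d′ = n ℕ.+ 2 * n
  bound : ∀ {k} → k ≤ n → k ℕ.+ 2 * k ≤ d′
  bound k≤n = ℕ.+-mono-≤ k≤n (ℕ.*-monoʳ-≤ 2 k≤n)
  -x-1≡ : ∀ x → - (x + 1ℚ) ≡ - 1ℚ - x
  -x-1≡ = solve-∀ ℚ-ring
  reflected : ∀ m → Degree≤ (m ℕ.+ 2 * m) (λ x → h m (- 1ℚ - x))
  reflected m = Degree≤-resp-≗ _ (λ x → cong (h m) (-x-1≡ x))
                  (Degree≤-translate _ 1ℚ (Degree≤-reflect _ (h-degree m)))

-- H(x) = H(x-1) / (1 - (x²-1) t) by h-suc, while x ↦ -1-x turns this into H(-1-x) = H(-x) (1 - (x²-1) t).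
Q-periodic : ∀ n x → Q n x ≡ Q n (x - 1ℚ)
Q-periodic n x = ⋆-cancel-geometric (λ k → h k x) (λ k → h k (x - 1ℚ)) (λ k → h k (- 1ℚ - x)) (λ k → h k z) a h≡ h′≡ n
  where
  one : ∀ a → 1ℚ + a · 0ℚ ≡ 1ℚ
  one = solve-∀ ℚ-ring
  one′ : ∀ a → 1ℚ + - a · 0ℚ ≡ 1ℚ
  one′ = solve-∀ ℚ-ring
  reflect : ∀ x → - 1ℚ - x ≡ - 1ℚ - (x - 1ℚ) - 1ℚ
  reflect = solve-∀ ℚ-ring
  z²≡x² : ∀ x → (- 1ℚ - (x - 1ℚ)) · (- 1ℚ - (x - 1ℚ)) ≡ x · x
  z²≡x² = solve-∀ ℚ-ring
  isolate : ∀ p r → p + r + - r ≡ p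
  isolate = solve-∀ ℚ-ring
  neg-mul : ∀ r s → - (r · s) ≡ - r · s
  neg-mul = solve-∀ ℚ-ring
  a = x · x - 1ℚ
  z = - 1ℚ - (x - 1ℚ)
  h≡ : ∀ k → h k x ≡ h k (x - 1ℚ) + a · shift (λ k → h k x) k
  h≡ zero    = trans (h-zero x) (sym (trans (cong (_+ a · 0ℚ) (h-zero (x - 1ℚ))) (one a)))
  h≡ (suc k) = h-suc k x
  h′≡ : ∀ k → h k (- 1ℚ - x) ≡ h k z + - a · shift (λ k → h k z) k
  h′≡ zero    = trans (h-zero (- 1ℚ - x)) (sym (trans (cong (_+ - a · 0ℚ) (h-zero z)) (one′ a)))
  h′≡ (suc k) = begin
    h (suc k) (- 1ℚ - x)                              ≡⟨ cong (h (suc k)) (reflect x) ⟩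
    h (suc k) (z - 1ℚ)                                ≡⟨ isolate (h (suc k) (z - 1ℚ)) ((z · z - 1ℚ) · h k z) ⟨
    h (suc k) (z - 1ℚ) + (z · z - 1ℚ) · h k z + - ((z · z - 1ℚ) · h k z)
        ≡⟨ cong (_+ - ((z · z - 1ℚ) · h k z)) (h-suc k z) ⟨
    h (suc k) z + - ((z · z - 1ℚ) · h k z)            ≡⟨ cong (λ t → h (suc k) z + - ((t - 1ℚ) · h k z)) (z²≡x² x) ⟩
    h (suc k) z + - (a · h k z)                       ≡⟨ cong (h (suc k) z +_) (neg-mul a (h k z)) ⟩
    h (suc k) z + - a · h k z                         ∎
    where open ≡-Reasoning

rising-0 : ∀ k → rising 0ℚ (suc k) ≡ 0ℚ
rising-0 zero    = refl
rising-0 (suc k) = trans (cong (_· (0ℚ + fromℕ (suc k))) (rising-0 k)) (*-zeroˡ (0ℚ + fromℕ (suc k)))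

h[1+k]-at-0 : ∀ k → h (suc k) 0ℚ ≡ 0ℚ
h[1+k]-at-0 k = trans (cong (_· F (suc k) (0ℚ - 1ℚ)) (rising-0 k)) (*-zeroˡ (F (suc k) (0ℚ - 1ℚ)))

h[1+k]-at--1 : ∀ k → h (suc k) (- 1ℚ) ≡ h k 0ℚ
h[1+k]-at--1 k = begin
  h (suc k) (0ℚ - 1ℚ)                                          ≡⟨ isolate (h (suc k) (0ℚ - 1ℚ)) (h k 0ℚ) ⟨
  h (suc k) (0ℚ - 1ℚ) + (0ℚ · 0ℚ - 1ℚ) · h k 0ℚ - (0ℚ · 0ℚ - 1ℚ) · h k 0ℚ
                                                               ≡⟨ cong (_- (0ℚ · 0ℚ - 1ℚ) · h k 0ℚ) (h-suc k 0ℚ) ⟨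
  h (suc k) 0ℚ - (0ℚ · 0ℚ - 1ℚ) · h k 0ℚ                       ≡⟨ cong (_- (0ℚ · 0ℚ - 1ℚ) · h k 0ℚ) (h[1+k]-at-0 k) ⟩
  0ℚ - (0ℚ · 0ℚ - 1ℚ) · h k 0ℚ                                 ≡⟨ simplify (h k 0ℚ) ⟩
  h k 0ℚ                                                       ∎
  where
  open ≡-Reasoning
  isolate : ∀ p q → p + (0ℚ · 0ℚ - 1ℚ) · q - (0ℚ · 0ℚ - 1ℚ) · q ≡ p
  isolate = solve-∀ ℚ-ring
  simplify : ∀ q → 0ℚ - (0ℚ · 0ℚ - 1ℚ) · q ≡ q
  simplify = solve-∀ ℚ-ring

Q-at-0 : ∀ n → Q n 0ℚ ≡ binomial 1ℚ n
Q-at-0 zero    = cong₂ _·_ (h-zero 0ℚ) (h-zero (- 1ℚ - 0ℚ))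
Q-at-0 (suc n) = begin
  h 0 0ℚ · h (suc n) (- 1ℚ - 0ℚ) + ∑[ k ≤ n ] (h (suc k) 0ℚ · h (n ∸ k) (- 1ℚ - 0ℚ))
      ≡⟨ cong₂ _+_ (cong₂ _·_ (h-zero 0ℚ) (h[1+k]-at--1 n))
                   (∑-zero n (λ k _ → trans (cong (_· h (n ∸ k) (- 1ℚ - 0ℚ)) (h[1+k]-at-0 k)) (*-zeroˡ (h (n ∸ k) (- 1ℚ - 0ℚ))))) ⟩
  1ℚ · h n 0ℚ + 0ℚ                  ≡⟨ trans (+-identityʳ (1ℚ · h n 0ℚ)) (*-identityˡ (h n 0ℚ)) ⟩
  h n 0ℚ                            ≡⟨ h-at-0 n ⟩
  binomial 1ℚ (suc n)               ∎
  where
  open ≡-Reasoning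
  h-at-0 : ∀ n → h n 0ℚ ≡ binomial 1ℚ (suc n)
  h-at-0 zero    = h-zero 0ℚ
  h-at-0 (suc n) = trans (h[1+k]-at-0 n) (sym (binomial-1 n))

-- Q n is a polynomial that is 1-periodic, hence constant.
Q-constant : ∀ n x → Q n x ≡ Q n 0ℚ
Q-constant n x = begin
  Q n x                        ≡⟨ add-back (Q n x) (Q n 0ℚ) ⟨
  Q n x - Q n 0ℚ + Q n 0ℚ
      ≡⟨ cong (_+ Q n 0ℚ) (vanishes-on-ℕ⇒≡0 _ difference-degree (λ j → trans (cong (_- Q n 0ℚ) (Q-at-ℕ j)) (+-inverseʳ (Q n 0ℚ))) x) ⟩
  0ℚ + Q n 0ℚ                  ≡⟨ +-identityˡ (Q n 0ℚ) ⟩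
  Q n 0ℚ                       ∎
  where
  open ≡-Reasoning
  add-back : ∀ a b → a - b + b ≡ a
  add-back = solve-∀ ℚ-ring
  x+1-1≡x : ∀ x → x + 1ℚ - 1ℚ ≡ x
  x+1-1≡x = solve-∀ ℚ-ring
  Q-at-ℕ : ∀ j → Q n (fromℕ j) ≡ Q n 0ℚ
  Q-at-ℕ zero    = refl
  Q-at-ℕ (suc j) = trans (Q-periodic n (fromℕ (suc j)))
                         (trans (cong (λ y → Q n (y - 1ℚ)) (fromℕ-suc j)) (trans (cong (Q n) (x+1-1≡x (fromℕ j))) (Q-at-ℕ j)))
  difference-degree : Degree≤ _ (λ y → Q n y - Q n 0ℚ)
  difference-degree = Degree≤-+ _ (Q-degree n) (Degree≤-const _ (- Q n 0ℚ))

-- At x = -1/2 the two factors of Q coincide, so H(-1/2)² = 1 + t = (√(1+t))².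
h-at--½ : ∀ k → h k -½ ≡ binomial ½ k
h-at--½ = ⋆-self-injective (λ k → h k -½) (binomial ½) (h-zero -½) refl λ n → begin
  Q n -½                        ≡⟨ Q-constant n -½ ⟩
  Q n 0ℚ                        ≡⟨ Q-at-0 n ⟩
  binomial 1ℚ n                 ≡⟨ vandermonde n ½ ½ ⟨
  (binomial ½ ⋆ binomial ½) n   ∎
  where open ≡-Reasoning

rising--½≢0 : ∀ k → rising -½ k ≢ 0ℚ
rising--½≢0 zero    ()
rising--½≢0 (suc k) = *-≢0 (rising--½≢0 k) -½+k≢0
  where
  double : ∀ x → fromℕ 2 · x ≡ fromℕ 2 · (-½ + x) + 1ℚ
  double = solve-∀ ℚ-ring
  -½+k≢0 : -½ + fromℕ k ≢ 0ℚ
  -½+k≢0 -½+k≡0 with ℕ.m*n≡1⇒m≡1 2 k (fromℕ-injective (begin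
    fromℕ (2 * k)                  ≡⟨ fromℕ-homo-* 2 k ⟩
    fromℕ 2 · fromℕ k                ≡⟨ double (fromℕ k) ⟩
    fromℕ 2 · (-½ + fromℕ k) + 1ℚ    ≡⟨ cong (λ t → fromℕ 2 · t + 1ℚ) -½+k≡0 ⟩
    fromℕ 1                          ∎))
    where open ≡-Reasoning
  ... | ()

F-at--3/2 : ∀ n → F n (- 3/2) ≡ sign n · invFact n
F-at--3/2 n = *-cancelˡ-≢0 (rising--½≢0 n) (begin
  rising -½ n · F n (- 3/2)           ≡⟨ h-at--½ n ⟩
  binomial ½ n                        ≡⟨ binomial-½ n ⟩
  sign n · rising -½ n · invFact n    ≡⟨ reorder (sign n) (rising -½ n) (invFact n) ⟩
  rising -½ n · (sign n · invFact n)  ∎)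
  where
  open ≡-Reasoning
  reorder : ∀ s p f → s · p · f ≡ p · (s · f)
  reorder = solve-∀ ℚ-ring

private
  gammaDenominator : ℕ → ℕ
  gammaDenominator ω = 4 ^ (ω ℕ.+ 2) * (ω ℕ.+ 2) !

  gammaDenominator≢0 : ∀ ω → NonZero (gammaDenominator ω)
  gammaDenominator≢0 ω = m*n≢0 (4 ^ (ω ℕ.+ 2)) ((ω ℕ.+ 2) !) {{m^n≢0 4 (ω ℕ.+ 2)}} {{(ω ℕ.+ 2) !≢0}}

  -- (2ω+6)(2ω+5) = 4 (ω+3) (ω+1+3/2)
  gammaNumerator-suc : ∀ ω → fromℕ ((2 * suc ω ℕ.+ 4) !) ≡
    fromℕ (4 * (ω ℕ.+ 3)) · (3/2 + fromℕ (suc ω)) · fromℕ ((2 * ω ℕ.+ 4) !)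
  gammaNumerator-suc ω = begin
    fromℕ ((2 * suc ω ℕ.+ 4) !)                                   ≡⟨ cong (λ m → fromℕ (m !)) (unfold ω) ⟩
    fromℕ (suc (suc K) * (suc K * K !))
        ≡⟨ trans (fromℕ-homo-* (suc (suc K)) (suc K * K !)) (cong (fromℕ (suc (suc K)) ·_) (fromℕ-homo-* (suc K) (K !))) ⟩
    fromℕ (suc (suc K)) · (fromℕ (suc K) · fromℕ (K !))
        ≡⟨ cong₂ (λ a b → fromℕ a · (b · fromℕ (K !))) (even ω) (trans (cong fromℕ (odd ω)) (fromℕ-odd (suc ω))) ⟩
    fromℕ (2 * (ω ℕ.+ 3)) · (fromℕ 2 · (fromℕ (suc ω) + 3/2) · fromℕ (K !))
        ≡⟨ cong (_· (fromℕ 2 · (fromℕ (suc ω) + 3/2) · fromℕ (K !))) (fromℕ-homo-* 2 (ω ℕ.+ 3)) ⟩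
    fromℕ 2 · fromℕ (ω ℕ.+ 3) · (fromℕ 2 · (fromℕ (suc ω) + 3/2) · fromℕ (K !))
        ≡⟨ regroup (fromℕ (ω ℕ.+ 3)) (fromℕ (suc ω)) (fromℕ (K !)) ⟩
    fromℕ 4 · fromℕ (ω ℕ.+ 3) · (3/2 + fromℕ (suc ω)) · fromℕ (K !)
        ≡⟨ cong (λ t → t · (3/2 + fromℕ (suc ω)) · fromℕ (K !)) (fromℕ-homo-* 4 (ω ℕ.+ 3)) ⟨
    fromℕ (4 * (ω ℕ.+ 3)) · (3/2 + fromℕ (suc ω)) · fromℕ (K !) ∎
    where
    open ≡-Reasoning
    regroup : ∀ a x f → fromℕ 2 · a · (fromℕ 2 · (x + 3/2) · f) ≡ fromℕ 4 · a · (3/2 + x) · f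
    regroup = solve-∀ ℚ-ring
    K = 2 * ω ℕ.+ 4
    unfold : ∀ ω → 2 * suc ω ℕ.+ 4 ≡ suc (suc (2 * ω ℕ.+ 4))
    unfold = ℕ-Solver.solve-∀
    even : ∀ ω → suc (suc (2 * ω ℕ.+ 4)) ≡ 2 * (ω ℕ.+ 3)
    even = ℕ-Solver.solve-∀
    odd : ∀ ω → suc (2 * ω ℕ.+ 4) ≡ 3 ℕ.+ 2 * suc ω
    odd = ℕ-Solver.solve-∀

  gammaDenominator-suc : ∀ ω → gammaDenominator (suc ω) ≡ 4 * (ω ℕ.+ 3) * gammaDenominator ω
  gammaDenominator-suc ω = regroup (4 ^ (ω ℕ.+ 2)) ((ω ℕ.+ 2) !) ω
    where
    regroup : ∀ p f ω → 4 * p * (suc (ω ℕ.+ 2) * f) ≡ 4 * (ω ℕ.+ 3) * (p * f)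
    regroup = ℕ-Solver.solve-∀

  gammaNumerator : ∀ ω → fromℕ ((2 * ω ℕ.+ 4) !) ≡ ½ · rising 3/2 (suc ω) · fromℕ (gammaDenominator ω)
  gammaNumerator zero    = refl
  gammaNumerator (suc ω) = begin
    fromℕ ((2 * suc ω ℕ.+ 4) !)                                       ≡⟨ gammaNumerator-suc ω ⟩
    c · (3/2 + fromℕ (suc ω)) · fromℕ ((2 * ω ℕ.+ 4) !)               ≡⟨ cong (c · (3/2 + fromℕ (suc ω)) ·_) (gammaNumerator ω) ⟩
    c · (3/2 + fromℕ (suc ω)) · (½ · rising 3/2 (suc ω) · fromℕ (gammaDenominator ω))
        ≡⟨ regroup c (3/2 + fromℕ (suc ω)) (rising 3/2 (suc ω)) (fromℕ (gammaDenominator ω)) ⟩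
    ½ · (rising 3/2 (suc ω) · (3/2 + fromℕ (suc ω))) · (c · fromℕ (gammaDenominator ω))
        ≡⟨ cong (½ · rising 3/2 (suc (suc ω)) ·_) (trans (sym (fromℕ-homo-* (4 * (ω ℕ.+ 3)) (gammaDenominator ω))) (cong fromℕ (sym (gammaDenominator-suc ω)))) ⟩
    ½ · rising 3/2 (suc (suc ω)) · fromℕ (gammaDenominator (suc ω))     ∎
    where
    open ≡-Reasoning
    regroup : ∀ c y r d → c · y · (½ · r · d) ≡ ½ · (r · y) · (c · d)
    regroup = solve-∀ ℚ-ring
    c = fromℕ (4 * (ω ℕ.+ 3))

gamma≡½·rising : ∀ ω → gammaOmegaPlus5/2OverSqrtPi ω ≡ ½ · rising 3/2 (suc ω)
gamma≡½·rising ω = begin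
  gammaOmegaPlus5/2OverSqrtPi ω                                    ≡⟨ /≡fromℤ·1/ℕ (ℤ.+ ((2 * ω ℕ.+ 4) !)) (gammaDenominator ω) ⟩
  fromℕ ((2 * ω ℕ.+ 4) !) · 1/ℕ (gammaDenominator ω)             ≡⟨ cong (_· 1/ℕ (gammaDenominator ω)) (gammaNumerator ω) ⟩
  ½ · rising 3/2 (suc ω) · fromℕ (gammaDenominator ω) · 1/ℕ (gammaDenominator ω)
      ≡⟨ *-assoc (½ · rising 3/2 (suc ω)) (fromℕ (gammaDenominator ω)) (1/ℕ (gammaDenominator ω)) ⟩
  ½ · rising 3/2 (suc ω) · (fromℕ (gammaDenominator ω) · 1/ℕ (gammaDenominator ω))
      ≡⟨ cong (½ · rising 3/2 (suc ω) ·_) (1/ℕ-inverseʳ (gammaDenominator ω)) ⟩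
  ½ · rising 3/2 (suc ω) · 1ℚ                                      ≡⟨ *-identityʳ (½ · rising 3/2 (suc ω)) ⟩
  ½ · rising 3/2 (suc ω)                                           ∎
  where
  open ≡-Reasoning
  instance _ = gammaDenominator≢0 ω

lhsOverSqrtPi≡ : ∀ n ω → lhsOverSqrtPi n ω ≡
  gammaOmegaPlus5/2OverSqrtPi ω · -½ · ∑[ j ≤ ω ] (weight ω j · 1/ℕ (3 ℕ.+ 2 * j) · F n (fromℕ j))
lhsOverSqrtPi≡ n ω = trans (sumTo≡∑ ω summand) (trans (∑-cong ω summand≡) (∑-*ˡ ω (G · -½) U))
  where
  G = gammaOmegaPlus5/2OverSqrtPi ω
  regroup : ∀ G a b r s f c d → G · a · b · r · (-½ · s · f · c · d) ≡ G · -½ · (s · d · a · r · f) · (c · b)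
  regroup = solve-∀ ℚ-ring
  summand : ℕ → ℚ
  summand j = G · invFact (ω ∸ j) · invFact (j ℕ.+ n) · 1/ℕ (3 ℕ.+ 2 * j) · innerSum n j
  U : ℕ → ℚ
  U j = weight ω j · 1/ℕ (3 ℕ.+ 2 * j) · F n (fromℕ j)
  summand≡ : ∀ j → summand j ≡ G · -½ · U j
  summand≡ j = begin
    summand j
        ≡⟨ cong (G · invFact (ω ∸ j) · invFact (j ℕ.+ n) · 1/ℕ (3 ℕ.+ 2 * j) ·_) (trans (innerSum≡inner n j) (inner≡F n j)) ⟩
    G · invFact (ω ∸ j) · invFact (j ℕ.+ n) · 1/ℕ (3 ℕ.+ 2 * j) · (-½ · sign j · F n (fromℕ j) · fromℕ ((j ℕ.+ n) !) · invFact j)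
        ≡⟨ regroup G (invFact (ω ∸ j)) (invFact (j ℕ.+ n)) (1/ℕ (3 ℕ.+ 2 * j)) (sign j) (F n (fromℕ j)) (fromℕ ((j ℕ.+ n) !)) (invFact j) ⟩
    G · -½ · U j · (fromℕ ((j ℕ.+ n) !) · invFact (j ℕ.+ n))
        ≡⟨ cong (G · -½ · U j ·_) (1/ℕ-inverseʳ ((j ℕ.+ n) !) {{(j ℕ.+ n) !≢0}}) ⟩
    G · -½ · U j · 1ℚ
        ≡⟨ *-identityʳ (G · -½ · U j) ⟩
    G · -½ · U j ∎
    where open ≡-Reasoning

rhsOverSqrtPi≡ : ∀ n → rhsOverSqrtPi n ≡ - sign n · (½ · ½ · ½) · invFact n
rhsOverSqrtPi≡ n = cong (_· invFact n) (trans (/≡fromℤ·1/ℕ (sgn (suc n)) 8) (cong (_· 1/ℕ 8) (sign-suc n)))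

-- The identity also holds for n = 0.
theorem1p3 : (n ω : ℕ) → 1 ≤ n → 2 * n ≤ ω → lhsOverSqrtPi n ω ≡ rhsOverSqrtPi n
theorem1p3 n ω _ 2n≤ω = begin
  lhsOverSqrtPi n ω                                ≡⟨ lhsOverSqrtPi≡ n ω ⟩
  G · -½ · ∑[ j ≤ ω ] (weight ω j · 1/ℕ (3 ℕ.+ 2 * j) · F n (fromℕ j))
                                                   ≡⟨ cong (G · -½ ·_) (∑-weight/odd·poly (2 * n) (F-degree n) ω 2n≤ω) ⟩
  G · -½ · (F n (- 3/2) · β ω 0)                   ≡⟨ cong₂ (λ g f → g · -½ · (f · β ω 0)) (gamma≡½·rising ω) (F-at--3/2 n) ⟩
  ½ · r · -½ · (sign n · invFact n · β ω 0)        ≡⟨ regroup r (sign n) (invFact n) (β ω 0) ⟩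
  - sign n · (½ · ½ · ½) · invFact n · (fromℕ 2 · β ω 0 · r)
                                                   ≡⟨ cong (- sign n · (½ · ½ · ½) · invFact n ·_) (β-rising ω 0) ⟩
  - sign n · (½ · ½ · ½) · invFact n · 1ℚ          ≡⟨ *-identityʳ (- sign n · (½ · ½ · ½) · invFact n) ⟩
  - sign n · (½ · ½ · ½) · invFact n               ≡⟨ rhsOverSqrtPi≡ n ⟨
  rhsOverSqrtPi n                                  ∎
  where
  open ≡-Reasoning
  regroup : ∀ r s f b → ½ · r · -½ · (s · f · b) ≡ - s · (½ · ½ · ½) · f · (fromℕ 2 · b · r)
  regroup = solve-∀ ℚ-ring
  G = gammaOmegaPlus5/2OverSqrtPi ω
  r = rising 3/2 (suc ω)
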